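{- Let $\Sigma=\{c_1,\dots,c_\sigma\}$ be an alphabet, let $s$ be a primitive string over $\Sigma$, and let $M_*(s)$ be the matrix of cyclic rotations of $s$ sorted according to a family of context adaptive alphabet orderings $\{\pi_x\}$. Let $x$ be a string, suppose $\mathrm{Rngx}(x)=[b_x,\ell_1,\ell_2,\dots,\ell_\sigma]$ and the permutation $\pi_x$ are given. Then the set of values $\mathrm{Rng}(xc_i)$ for all $c_i\in\Sigma$ can be computed in $\mathcal{O}(\sigma)$ time.
   Context: A string is primitive if all its cyclic rotations are distinct. A context adaptive BWT is defined as follows: for every string $x$ an ordering (permutation) $\pi_x$ of $\Sigma$ is fixed. The matrix $M_*(s)$ has as rows all cyclic rotations of $s$, sorted so that, for two distinct rotations whose longest common prefix is $x$, the one whose $(|x|+1)$-st symbol is smaller according to $\pi_x$ comes first. $BWT_*(s)$ is the last column of $M_*(s)$. The rows prefixed by a given string form a contiguous block of $M_*(s)$. For a string $x$, $\mathrm{Rng}(x)=[b_x,\ell_x]$ means that row $i$ of $M_*(s)$ is prefixed by $x$ iff $b_x\le i<b_x+\ell_x$ (with $\mathrm{Rng}(x)=[0,0]$ if no row is prefixed by $x$). $\mathrm{Rngx}(x)=[b_x,\ell_1,\dots,\ell_\sigma]$ denotes the $\sigma+1$ integers where $b_x$ is the lower extreme of $\mathrm{Rng}(x)$ and $\ell_i$ is the number of rows of $M_*(s)$ prefixed by $xc_i$. Computation model: word RAM. -}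

module Defs where

open import Data.Nat using (ℕ; zero; suc; _+_; _*_; _∸_; _<_; _≤_; _<ᵇ_; _≡ᵇ_)
open import Data.Nat.Properties using (_<?_)
open import Data.Fin using (Fin; toℕ; fromℕ<) renaming (_≟_ to _≟ᶠ_)
open import Data.Fin.Permutation using (Permutation′; _⟨$⟩ʳ_)
open import Data.List using (List; []; _∷_; _++_; drop; take; length; filter; allFin; lookup)
open import Data.Bool using (Bool; true; false; T; if_then_else_; _∧_)
open import Data.Product using (Σ; ∃; _×_; _,_)
open import Relation.Nullary using (yes; no; does)
open import Relation.Binary.PropositionalEquality using (_≡_)
open import Function.Definitions using (Bijective)

Str : ℕ → Set
Str σ = List (Fin σ)

rot : ∀ {σ} → ℕ → Str σ → Str σ
rot k s = drop k s ++ take k s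

Primitive : ∀ {σ} → Str σ → Set
Primitive s = ∀ (i j : Fin (length s)) → rot (toℕ i) s ≡ rot (toℕ j) s → i ≡ j

isPrefix : ∀ {σ} → Str σ → Str σ → Bool
isPrefix [] u = true
isPrefix (a ∷ x) [] = false
isPrefix (a ∷ x) (b ∷ u) = does (a ≟ᶠ b) ∧ isPrefix x u

-- A context adaptive family of orderings: for every string x a permutation
-- π_x of Σ; π_x ⟨$⟩ʳ c is the rank (position) of symbol c in the ordering π_x.
Orderings : ℕ → Set
Orderings σ = Str σ → Permutation′ σ

_≺[_]_ : ∀ {σ} → Str σ → Orderings σ → Str σ → Set
_≺[_]_ {σ} u π v = Σ (Str σ) λ x → Σ (Fin σ) λ c → Σ (Fin σ) λ d →
  Σ (Str σ) λ u′ → Σ (Str σ) λ v′ →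
    (u ≡ x ++ (c ∷ u′)) × (v ≡ x ++ (d ∷ v′)) ×
    (toℕ (π x ⟨$⟩ʳ c) < toℕ (π x ⟨$⟩ʳ d))

-- The matrix M_*(s) is represented by  row : Fin |s| → Fin |s| ,
-- row i = k meaning that row i of M_*(s) is the rotation rot k s.
-- IsMstar π s row : the rows are exactly all rotations, sorted.
IsMstar : ∀ {σ} → Orderings σ → (s : Str σ) → (Fin (length s) → Fin (length s)) → Set
IsMstar π s row = Bijective _≡_ _≡_ row ×
  (∀ i j → toℕ i < toℕ j → rot (toℕ (row i)) s ≺[ π ] rot (toℕ (row j)) s)

Row : ∀ {σ} (s : Str σ) → (Fin (length s) → Fin (length s)) → Fin (length s) → Str σ
Row s row i = rot (toℕ (row i)) s

HasRng : ∀ {σ} (s : Str σ) → (Fin (length s) → Fin (length s)) → Str σ → ℕ → ℕ → Set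
HasRng s row x b ℓ =
  (∀ i → (b ≤ toℕ i × toℕ i < b + ℓ → T (isPrefix x (Row s row i))) ×
         (T (isPrefix x (Row s row i)) → b ≤ toℕ i × toℕ i < b + ℓ)) ×
  (ℓ ≡ 0 → b ≡ 0)

countRows : ∀ {σ} (s : Str σ) → (Fin (length s) → Fin (length s)) → Str σ → ℕ
countRows s row x = length (filter (λ i → T? (isPrefix x (Row s row i))) (allFin (length s)))
  where
  open import Data.Bool.Properties using (T?)

HasRngx : ∀ {σ} (s : Str σ) → (Fin (length s) → Fin (length s)) → Str σ →
          ℕ → (Fin σ → ℕ) → Set
HasRngx s row x b ℓs = (Σ ℕ λ ℓ → HasRng s row x b ℓ) ×
  (∀ c → ℓs c ≡ countRows s row (x ++ (c ∷ [])))

-- A simple RAM model (registers indexed by ℕ holding naturals, unit cost).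

data Instr : Set where
  const : (r k : ℕ) → Instr
  add   : (r a b : ℕ) → Instr
  sub   : (r a b : ℕ) → Instr
  load  : (r a : ℕ) → Instr
  store : (a r : ℕ) → Instr
  jlt   : (a b t : ℕ) → Instr
  jmp   : (t : ℕ) → Instr

Program : Set
Program = List Instr

Mem : Set
Mem = ℕ → ℕ

record State : Set where
  constructor ⟨_,_⟩
  field
    pc  : ℕ
    mem : Mem
open State public

upd : Mem → ℕ → ℕ → Mem
upd m a v a′ = if a′ ≡ᵇ a then v else m a′

exec : Instr → ℕ → Mem → State
exec (const r k) p m = ⟨ suc p , upd m r k ⟩
exec (add r a b) p m = ⟨ suc p , upd m r (m a + m b) ⟩
exec (sub r a b) p m = ⟨ suc p , upd m r (m a ∸ m b) ⟩
exec (load r a)  p m = ⟨ suc p , upd m r (m (m a)) ⟩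
exec (store a r) p m = ⟨ suc p , upd m (m a) (m r) ⟩
exec (jlt a b t) p m = if m a <ᵇ m b then ⟨ t , m ⟩ else ⟨ suc p , m ⟩
exec (jmp t)     p m = ⟨ t , m ⟩

step : Program → State → State
step P ⟨ p , m ⟩ with p <? length P
... | yes q = exec (lookup P (fromℕ< q)) p m
... | no  _ = ⟨ p , m ⟩

run : Program → ℕ → State → State
run P zero    st = st
run P (suc t) st = run P t (step P st)

Halted : Program → State → Set
Halted P st = length P ≤ pc st

-- Input layout: R[0] = σ, R[1] = b_x, R[2+i] = ℓ_{i+1} (i < σ),
-- R[σ+2+i] = rank of c_{i+1} in π_x (i < σ), all other registers 0.
initMem : (σ : ℕ) → ℕ → (Fin σ → ℕ) → (Fin σ → ℕ) → Mem
initMem σ b ℓs rk zero = σ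
initMem σ b ℓs rk (suc zero) = b
initMem σ b ℓs rk (suc (suc k)) with k <? σ
... | yes p = ℓs (fromℕ< p)
... | no _ with k ∸ σ <? σ
...   | yes q = rk (fromℕ< q)
...   | no _  = 0

-- Output layout: Rng(x c_{i+1}) = [R[2σ+2+2i] , R[2σ+3+2i]]
outB outL : (σ : ℕ) → Fin σ → ℕ
outB σ i = 2 * σ + 2 + 2 * toℕ i
outL σ i = 2 * σ + 3 + 2 * toℕ i

module Submission where

-- The rows prefixed by x form the block [b, b + ℓ). The rows are sorted by the π_x-rank of the
-- symbol following x, so within the block that rank is nondecreasing (a row ending right after x
-- counting as rank σ). Hence the rows prefixed by x c form the interval that starts at b plus the
-- number of block rows whose next symbol has smaller rank, i.e. b + Σ { ℓ_d : π_x(d) < π_x(c) },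
-- and has length ℓ_c. These σ prefix sums over the symbols taken in π_x-order are computed in O(σ)
-- steps by writing each ℓ_d into a table at position π_x(d), summing the table, and reading back.

open import Defs
open import Data.Nat using (ℕ; _+_; _*_; _≤_)
open import Data.Fin using (Fin; toℕ)
open import Data.Fin.Permutation using (_⟨$⟩ʳ_)
open import Data.List using (List; []; _∷_; _++_; length)
open import Data.Product using (Σ; _×_; _,_; proj₁; proj₂)
open import Relation.Binary.PropositionalEquality using (sym; subst₂)

module Machine where

  open import Data.Nat
  open import Data.Nat.Properties
  open import Data.Bool using (true; false; T)
  open import Data.Empty using (⊥-elim)
  open import Data.Product using (_×_)
  open import Relation.Binary.PropositionalEquality

  ≡ᵇ-refl : ∀ n → (n ≡ᵇ n) ≡ true
  ≡ᵇ-refl zero = refl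
  ≡ᵇ-refl (suc n) = ≡ᵇ-refl n

  ≢⇒≡ᵇ-false : ∀ a b → a ≢ b → (a ≡ᵇ b) ≡ false
  ≢⇒≡ᵇ-false zero zero ne = ⊥-elim (ne refl)
  ≢⇒≡ᵇ-false zero (suc b) ne = refl
  ≢⇒≡ᵇ-false (suc a) zero ne = refl
  ≢⇒≡ᵇ-false (suc a) (suc b) ne = ≢⇒≡ᵇ-false a b (λ e → ne (cong suc e))

  upd-other : ∀ m x v a → a ≢ x → upd m x v a ≡ m a
  upd-other m x v a ne rewrite ≢⇒≡ᵇ-false a x ne = refl

  upd-same : ∀ m x v a → a ≡ x → upd m x v a ≡ v
  upd-same m x v a refl rewrite ≡ᵇ-refl a = refl

  <⇒<ᵇ-true : ∀ {x y} → x < y → (x <ᵇ y) ≡ true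
  <⇒<ᵇ-true {x} {y} p with x <ᵇ y | <⇒<ᵇ p
  ... | true | _ = refl

  ≥⇒<ᵇ-false : ∀ {x y} → y ≤ x → (x <ᵇ y) ≡ false
  ≥⇒<ᵇ-false {x} {y} p with x <ᵇ y in eq
  ... | false = refl
  ... | true = ⊥-elim (<⇒≱ (<ᵇ⇒< x y (subst T (sym eq) _)) p)

  module Hoare (P : Program) where

    run-+ : ∀ a b st → run P (a + b) st ≡ run P b (run P a st)
    run-+ zero b st = refl
    run-+ (suc a) b st = run-+ a b (step P st)

    Pred : Set₁
    Pred = State → Set

    -- A record, so that `_⨾_` can infer pre-, postconditions and running times.
    record Triple (A : Pred) (t : ℕ) (B : Pred) : Set where
      field holds : ∀ st → A st → B (run P t st)
    open Triple public

    infixr 4 _⨾_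
    _⨾_ : ∀ {A B C t₁ t₂} → Triple A t₁ B → Triple B t₂ C → Triple A (t₁ + t₂) C
    (_⨾_ {C = C} {t₁} {t₂} h₁ h₂) .holds st a =
      subst C (sym (run-+ t₁ t₂ st)) (h₂ .holds _ (h₁ .holds st a))

    loop : (I : ℕ → Pred) (B : Pred) (k e : ℕ) →
           (∀ n → Triple (I (suc n)) k (I n)) → Triple (I 0) e B →
           ∀ n → Triple (I n) (n * k + e) B
    loop I B k e body ex zero = ex
    loop I B k e body ex (suc n) =
      subst (λ t → Triple (I (suc n)) t B) (sym (+-assoc k (n * k) e)) (body n ⨾ loop I B k e body ex n)

    At : ℕ → (Mem → Set) → Pred
    At L F st = pc st ≡ L × F (mem st)

    jlt-taken : ∀ {k L a b t m} → step P ⟨ L , m ⟩ ≡ exec (jlt a b t) L m → (m a <ᵇ m b) ≡ true →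
                run P (suc k) ⟨ L , m ⟩ ≡ run P k ⟨ t , m ⟩
    jlt-taken {k} e c rewrite e | c = refl

    jlt-skipped : ∀ {k L a b t m} → step P ⟨ L , m ⟩ ≡ exec (jlt a b t) L m → (m a <ᵇ m b) ≡ false →
                  run P (suc k) ⟨ L , m ⟩ ≡ run P k ⟨ suc L , m ⟩
    jlt-skipped {k} e c rewrite e | c = refl

module Counting where

  open import Data.Nat
  open import Data.Nat.Properties
  open import Data.Bool using (Bool; true; false; T)
  open import Data.Bool.Properties using (T?)
  open import Data.Product using (_×_; _,_; proj₁; proj₂)
  open import Data.Sum using (_⊎_; inj₁; inj₂; [_,_]′)
  import Data.Sum as Sum
  open import Data.List using (length; filter; allFin; tabulate)
  open import Data.Fin using (Fin; toℕ; fromℕ<; zero; suc)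
  open import Data.Empty using (⊥; ⊥-elim)
  open import Data.Unit using (tt)
  open import Function using (_∘_; id)
  open import Relation.Binary.PropositionalEquality hiding ([_])
  open import Relation.Nullary using (yes; no)
  open import Data.Nat.Tactic.RingSolver using (solve-∀)

  [_] : Bool → ℕ
  [ true ] = 1
  [ false ] = 0

  countBelow : (ℕ → Bool) → ℕ → ℕ
  countBelow g zero = 0
  countBelow g (suc k) = countBelow g k + [ g k ]

  countFin : ∀ n → (Fin n → Bool) → ℕ
  countFin zero q = 0
  countFin (suc n) q = [ q zero ] + countFin n (q ∘ suc)

  extend : ∀ {n} → (Fin n → Bool) → ℕ → Bool
  extend {zero} q _ = false
  extend {suc n} q zero = q zero
  extend {suc n} q (suc i) = extend (q ∘ suc) i

  extend-toℕ : ∀ {n} (q : Fin n → Bool) (i : Fin n) → extend q (toℕ i) ≡ q i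
  extend-toℕ {suc n} q zero = refl
  extend-toℕ {suc n} q (suc i) = extend-toℕ (q ∘ suc) i

  extend-fromℕ< : ∀ {n} (q : Fin n → Bool) i (p : i < n) → extend q i ≡ q (fromℕ< p)
  extend-fromℕ< {suc n} q zero p = refl
  extend-fromℕ< {suc n} q (suc i) (s≤s p) = extend-fromℕ< (q ∘ suc) i p

  extend-≥ : ∀ {n} (q : Fin n → Bool) i → n ≤ i → extend q i ≡ false
  extend-≥ {zero} q i _ = refl
  extend-≥ {suc n} q (suc i) (s≤s le) = extend-≥ (q ∘ suc) i le

  extend-cong : ∀ {n} (q q′ : Fin n → Bool) → (∀ i → q i ≡ q′ i) → ∀ i → extend q i ≡ extend q′ i
  extend-cong {zero} q q′ h i = refl
  extend-cong {suc n} q q′ h zero = h zero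
  extend-cong {suc n} q q′ h (suc i) = extend-cong (q ∘ suc) (q′ ∘ suc) (h ∘ suc) i

  extend-false : ∀ {n} (q : Fin n → Bool) → (∀ i → q i ≡ false) → ∀ i → extend q i ≡ false
  extend-false {zero} q h i = refl
  extend-false {suc n} q h zero = h zero
  extend-false {suc n} q h (suc i) = extend-false (q ∘ suc) (h ∘ suc) i

  extend-[+] : ∀ {n} (q q₁ q₂ : Fin n → Bool) → (∀ i → [ q i ] ≡ [ q₁ i ] + [ q₂ i ]) →
               ∀ i → [ extend q i ] ≡ [ extend q₁ i ] + [ extend q₂ i ]
  extend-[+] {zero} q q₁ q₂ h i = refl
  extend-[+] {suc n} q q₁ q₂ h zero = h zero
  extend-[+] {suc n} q q₁ q₂ h (suc i) = extend-[+] (q ∘ suc) (q₁ ∘ suc) (q₂ ∘ suc) (h ∘ suc) i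

  countBelow-suc′ : ∀ g k → countBelow g (suc k) ≡ [ g 0 ] + countBelow (g ∘ suc) k
  countBelow-suc′ g zero = +-comm 0 [ g 0 ]
  countBelow-suc′ g (suc k) =
    trans (cong (_+ [ g (suc k) ]) (countBelow-suc′ g k)) (+-assoc [ g 0 ] (countBelow (g ∘ suc) k) _)

  countFin≡countBelow : ∀ n q → countFin n q ≡ countBelow (extend q) n
  countFin≡countBelow zero q = refl
  countFin≡countBelow (suc n) q =
    trans (cong ([ q zero ] +_) (countFin≡countBelow n (q ∘ suc))) (sym (countBelow-suc′ (extend q) n))

  length-filter-tabulate : ∀ {A : Set} n (f : Fin n → A) (q : A → Bool) →
                           length (filter (λ a → T? (q a)) (tabulate f)) ≡ countFin n (q ∘ f)
  length-filter-tabulate zero f q = refl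
  length-filter-tabulate (suc n) f q with q (f zero)
  ... | true = cong suc (length-filter-tabulate n (f ∘ suc) q)
  ... | false = length-filter-tabulate n (f ∘ suc) q

  length-filter-allFin : ∀ n (q : Fin n → Bool) →
                         length (filter (λ i → T? (q i)) (allFin n)) ≡ countBelow (extend q) n
  length-filter-allFin n q = trans (length-filter-tabulate n id q) (countFin≡countBelow n q)

  countBelow-cong : ∀ g g′ k → (∀ i → i < k → g i ≡ g′ i) → countBelow g k ≡ countBelow g′ k
  countBelow-cong g g′ zero h = refl
  countBelow-cong g g′ (suc k) h =
    cong₂ _+_ (countBelow-cong g g′ k (λ i lt → h i (≤-trans lt (n≤1+n k)))) (cong [_] (h k ≤-refl))

  countBelow-+ : ∀ g g₁ g₂ k → (∀ i → [ g i ] ≡ [ g₁ i ] + [ g₂ i ]) →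
                 countBelow g k ≡ countBelow g₁ k + countBelow g₂ k
  countBelow-+ g g₁ g₂ zero h = refl
  countBelow-+ g g₁ g₂ (suc k) h =
    trans (cong₂ _+_ (countBelow-+ g g₁ g₂ k h) (h k)) (interchange (countBelow g₁ k) (countBelow g₂ k) [ g₁ k ] [ g₂ k ])
    where
    interchange : ∀ a b c d → (a + b) + (c + d) ≡ (a + c) + (b + d)
    interchange = solve-∀

  countBelow-none : ∀ g k → (∀ i → g i ≡ false) → countBelow g k ≡ 0
  countBelow-none g zero h = refl
  countBelow-none g (suc k) h rewrite h k | countBelow-none g k h = refl

  [<ᵇ-suc] : ∀ f v → [ f <ᵇ suc v ] ≡ [ f <ᵇ v ] + [ f ≡ᵇ v ]
  [<ᵇ-suc] zero zero = refl
  [<ᵇ-suc] zero (suc v) = refl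
  [<ᵇ-suc] (suc f) zero = refl
  [<ᵇ-suc] (suc f) (suc v) = [<ᵇ-suc] f v

  IntervalBelow : (ℕ → Bool) → ℕ → ℕ → ℕ → Set
  IntervalBelow g b k c = ∀ i → i < k → (T (g i) → b ≤ i × i < b + c) × (b ≤ i × i < b + c → T (g i))

  module _ (g : ℕ → Bool) (b : ℕ)
           (above : ∀ i → T (g i) → b ≤ i)
           (down-closed : ∀ i i′ → T (g i′) → b ≤ i → i ≤ i′ → T (g i)) where

    -- The second component strengthens the induction: the interval is empty or ends by k.
    interval-count : ∀ k → IntervalBelow g b k (countBelow g k) × (countBelow g k ≡ 0 ⊎ b + countBelow g k ≤ k)
    interval-count zero = (λ i ()) , inj₁ refl
    interval-count (suc k) with interval-count k | g k in gk≡
    ... | (seg , ends) | false = seg′ , ends′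
      where
      c = countBelow g k
      outside : b ≤ k → k < b + c → ⊥
      outside bk kc = [ (λ c≡0 → <⇒≱ (subst (λ z → k < b + z) c≡0 kc) (subst (_≤ k) (sym (+-identityʳ b)) bk))
                      , (λ le → <⇒≱ kc le) ]′ ends
      seg′ : IntervalBelow g b (suc k) (c + 0)
      seg′ i lt rewrite +-identityʳ c with i ≟ k
      ... | no i≢k = seg i (≤∧≢⇒< (≤-pred lt) i≢k)
      ... | yes refl = (λ t → ⊥-elim (subst T gk≡ t)) , λ (bi , ic) → ⊥-elim (outside bi ic)
      ends′ : c + 0 ≡ 0 ⊎ b + (c + 0) ≤ suc k
      ends′ rewrite +-identityʳ c = Sum.map₂ (λ le → ≤-trans le (n≤1+n k)) ends
    ... | (seg , ends) | true = seg′ , inj₂ (≤-reflexive b+c+1≡1+k)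
      where
      c = countBelow g k
      gk : T (g k)
      gk = subst T (sym gk≡) tt
      b≤k : b ≤ k
      b≤k = above k gk
      b+c≤k : b + c ≤ k
      b+c≤k = [ (λ c≡0 → subst (λ z → b + z ≤ k) (sym c≡0) (subst (_≤ k) (sym (+-identityʳ b)) b≤k))
              , id ]′ ends
      k≤b+c : k ≤ b + c
      k≤b+c with m≤n⇒m<n∨m≡n b≤k
      ... | inj₂ b≡k = subst (_≤ b + c) b≡k (m≤m+n b c)
      ... | inj₁ b<k = predecessor-inside k b<k seg gk
        where
        predecessor-inside : ∀ k → b < k → IntervalBelow g b k c → T (g k) → k ≤ b + c
        predecessor-inside (suc k′) (s≤s b≤k′) sg gk′ =
          proj₂ (proj₁ (sg k′ ≤-refl) (down-closed k′ (suc k′) gk′ b≤k′ (n≤1+n k′)))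
      b+c+1≡1+k : b + (c + 1) ≡ suc k
      b+c+1≡1+k = trans (sym (+-assoc b c 1)) (trans (cong (_+ 1) (≤-antisym b+c≤k k≤b+c)) (+-comm k 1))
      seg′ : IntervalBelow g b (suc k) (c + 1)
      seg′ i lt = (λ t → above i t , subst (i <_) (sym b+c+1≡1+k) lt)
                , λ (bi , ic) → down-closed i k gk bi (≤-pred (subst (i <_) b+c+1≡1+k ic))

module Strings where

  open import Data.Nat
  open import Data.Nat.Properties
  open import Data.Bool using (Bool; true; false; T; _∧_)
  open import Data.Product using (Σ; _,_)
  open import Data.List using (List; []; _∷_; _++_; length)
  open import Data.List.Properties using (∷-injective)
  open import Data.Maybe using (Maybe; just; nothing)
  open import Data.Fin using (Fin; toℕ) renaming (_≟_ to _≟ᶠ_)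
  open import Data.Fin.Permutation using (_⟨$⟩ʳ_)
  open import Data.Empty using (⊥-elim)
  open import Relation.Binary.PropositionalEquality
  open import Relation.Binary.Definitions using (tri<; tri≈; tri>)
  open import Relation.Nullary using (yes; no; does)

  nth : ∀ {A : Set} → List A → ℕ → Maybe A
  nth [] _ = nothing
  nth (a ∷ l) zero = just a
  nth (a ∷ l) (suc m) = nth l m

  nth-++-length : ∀ {A : Set} (y : List A) c u → nth (y ++ c ∷ u) (length y) ≡ just c
  nth-++-length [] c u = refl
  nth-++-length (a ∷ y) c u = nth-++-length y c u

  nth-++ˡ : ∀ {A : Set} (y w : List A) m → m < length y → nth (y ++ w) m ≡ nth y m
  nth-++ˡ (a ∷ y) w zero _ = refl
  nth-++ˡ (a ∷ y) w (suc m) (s≤s lt) = nth-++ˡ y w m lt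

  ++-cancel-length : ∀ {A : Set} (y x w w′ : List A) → length y ≡ length x → y ++ w ≡ x ++ w′ → y ≡ x
  ++-cancel-length [] [] w w′ _ _ = refl
  ++-cancel-length (a ∷ y) (a′ ∷ x) w w′ el e with ∷-injective e
  ... | a≡a′ , e′ = cong₂ _∷_ a≡a′ (++-cancel-length y x w w′ (suc-injective el) e′)

  isPrefix⇒++ : ∀ {σ} (x r : Str σ) → T (isPrefix x r) → Σ (Str σ) λ rest → r ≡ x ++ rest
  isPrefix⇒++ [] r _ = r , refl
  isPrefix⇒++ (a ∷ x) (c ∷ r) t with a ≟ᶠ c
  ... | yes refl with isPrefix⇒++ x r t
  ...   | rest , e = rest , cong (a ∷_) e

  isNext : ∀ {σ} → Fin σ → Maybe (Fin σ) → Bool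
  isNext c nothing = false
  isNext c (just d) = does (c ≟ᶠ d)

  isPrefix-∷ʳ : ∀ {σ} (x r : Str σ) c → isPrefix (x ++ c ∷ []) r ≡ isPrefix x r ∧ isNext c (nth r (length x))
  isPrefix-∷ʳ [] [] c = refl
  isPrefix-∷ʳ [] (d ∷ r) c with does (c ≟ᶠ d)
  ... | true = refl
  ... | false = refl
  isPrefix-∷ʳ (a ∷ x) [] c = refl
  isPrefix-∷ʳ (a ∷ x) (d ∷ r) c with does (a ≟ᶠ d)
  ... | true = isPrefix-∷ʳ x r c
  ... | false = refl

  -- A string with no symbol after the prefix x gets rank σ, above the rank of every symbol.
  rankOf : ∀ {σ} → Orderings σ → Str σ → Maybe (Fin σ) → ℕ
  rankOf {σ} π x nothing = σ
  rankOf π x (just c) = toℕ (π x ⟨$⟩ʳ c)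

  nextRank : ∀ {σ} → Orderings σ → Str σ → Str σ → ℕ
  nextRank π x u = rankOf π x (nth u (length x))

  ≺-nextRank-mono : ∀ {σ} (π : Orderings σ) x {u v} → u ≺[ π ] v →
                    T (isPrefix x u) → T (isPrefix x v) → nextRank π x u ≤ nextRank π x v
  ≺-nextRank-mono π x {u} {v} (y , c , d , u′ , v′ , u≡ , v≡ , c<d) xu xv
    with isPrefix⇒++ x u xu | isPrefix⇒++ x v xv | <-cmp (length y) (length x)
  ... | ru , u≡x++ | rv , v≡x++ | tri< y<x _ _ = ⊥-elim (<-irrefl (cong (λ z → toℕ (π y ⟨$⟩ʳ z)) c≡d) c<d)
    where
    symbol-of-x : ∀ {w e w′ r} → w ≡ y ++ e ∷ w′ → w ≡ x ++ r → just e ≡ nth x (length y)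
    symbol-of-x {w} {e} {w′} {r} w≡y w≡x = begin
      just e                   ≡⟨ sym (nth-++-length y e w′) ⟩
      nth (y ++ e ∷ w′) (length y) ≡⟨ cong (λ z → nth z (length y)) (trans (sym w≡y) w≡x) ⟩
      nth (x ++ r) (length y)  ≡⟨ nth-++ˡ x r (length y) y<x ⟩
      nth x (length y)         ∎
      where open ≡-Reasoning
    c≡d : c ≡ d
    c≡d with trans (symbol-of-x u≡ u≡x++) (sym (symbol-of-x v≡ v≡x++))
    ... | refl = refl
  ... | ru , u≡x++ | rv , v≡x++ | tri≈ _ |y|≡|x| _ = begin
    nextRank π x u        ≡⟨ cong (rankOf π x) (nth-after u≡) ⟩
    toℕ (π x ⟨$⟩ʳ c)     <⟨ subst (λ z → toℕ (π z ⟨$⟩ʳ c) < toℕ (π z ⟨$⟩ʳ d)) y≡x c<d ⟩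
    toℕ (π x ⟨$⟩ʳ d)     ≡⟨ cong (rankOf π x) (nth-after v≡) ⟨
    nextRank π x v        ∎
    where
    open ≤-Reasoning
    y≡x : y ≡ x
    y≡x = ++-cancel-length y x (c ∷ u′) ru |y|≡|x| (trans (sym u≡) u≡x++)
    nth-after : ∀ {w e w′} → w ≡ y ++ e ∷ w′ → nth w (length x) ≡ just e
    nth-after {e = e} {w′} refl = subst (λ k → nth (y ++ e ∷ w′) k ≡ just e) |y|≡|x| (nth-++-length y e w′)
  ... | _ | _ | tri> _ _ x<y = ≤-reflexive (cong (rankOf π x) (begin
    nth u (length x)                 ≡⟨ cong (λ z → nth z (length x)) u≡ ⟩
    nth (y ++ c ∷ u′) (length x)     ≡⟨ nth-++ˡ y (c ∷ u′) (length x) x<y ⟩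
    nth y (length x)                 ≡⟨ nth-++ˡ y (d ∷ v′) (length x) x<y ⟨
    nth (y ++ d ∷ v′) (length x)     ≡⟨ cong (λ z → nth z (length x)) v≡ ⟨
    nth v (length x)                 ∎))
    where open ≡-Reasoning

module Extension where

  open Counting
  open Strings
  open import Data.Nat
  open import Data.Nat.Properties
  open import Data.Bool using (Bool; true; false; T; _∧_; if_then_else_)
  open import Data.Bool.Properties using (T-∧)
  open import Data.Product using (Σ; _×_; _,_; proj₁; proj₂)
  open import Data.List using ([]; _∷_; _++_; length)
  open import Data.Maybe using (just; nothing)
  open import Data.Fin using (Fin; toℕ; fromℕ<) renaming (_≟_ to _≟ᶠ_)
  open import Data.Fin.Properties using (toℕ<n; toℕ-fromℕ<; fromℕ<-toℕ; toℕ-injective)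
  open import Data.Fin.Permutation using (Permutation′; _⟨$⟩ʳ_; _⟨$⟩ˡ_; inverseˡ; inverseʳ)
  open import Data.Empty using (⊥-elim)
  open import Data.Sum using (inj₁; inj₂)
  open import Data.Unit using (tt)
  open import Function using (Equivalence)
  open import Relation.Binary.PropositionalEquality hiding ([_])
  open import Relation.Nullary using (¬_; yes; no)

  open Equivalence using (to; from)

  rank : ∀ {σ} → Permutation′ σ → Fin σ → ℕ
  rank ρ c = toℕ (ρ ⟨$⟩ʳ c)

  rank< : ∀ {σ} (ρ : Permutation′ σ) c → rank ρ c < σ
  rank< ρ c = toℕ<n (ρ ⟨$⟩ʳ c)

  rank-injective : ∀ {σ} (ρ : Permutation′ σ) c d → rank ρ c ≡ rank ρ d → c ≡ d
  rank-injective ρ c d e =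
    trans (sym (inverseˡ ρ)) (trans (cong (ρ ⟨$⟩ˡ_) (toℕ-injective e)) (inverseˡ ρ))

  rank-surjective : ∀ {σ} (ρ : Permutation′ σ) r → r < σ → Σ (Fin σ) λ c → rank ρ c ≡ r
  rank-surjective ρ r r<σ = ρ ⟨$⟩ˡ fromℕ< r<σ , trans (cong toℕ (inverseʳ ρ)) (toℕ-fromℕ< r<σ)

  byRank : ∀ {σ} → Permutation′ σ → (Fin σ → ℕ) → ℕ → ℕ
  byRank {σ} ρ ℓs r with r <? σ
  ... | yes r<σ = ℓs (ρ ⟨$⟩ˡ fromℕ< r<σ)
  ... | no _ = 0

  byRank-rank : ∀ {σ} (ρ : Permutation′ σ) ℓs c → byRank ρ ℓs (rank ρ c) ≡ ℓs c
  byRank-rank {σ} ρ ℓs c with rank ρ c <? σ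
  ... | yes r<σ = cong ℓs (trans (cong (ρ ⟨$⟩ˡ_) (fromℕ<-toℕ (ρ ⟨$⟩ʳ c) r<σ)) (inverseˡ ρ))
  ... | no r≮σ = ⊥-elim (r≮σ (rank< ρ c))

  prefixSums : (ℕ → ℕ) → ℕ → ℕ
  prefixSums f zero = 0
  prefixSums f (suc r) = prefixSums f r + f r

  -- The paper's convention Rng(y) = [0, 0] for L = 0.
  rangeStart : ℕ → ℕ → ℕ
  rangeStart L B = if 0 <ᵇ L then B else 0

  hasRng-interval : ∀ {σ} (s : Str σ) row y B L →
                    (∀ i → T (isPrefix y (Row s row i)) → B ≤ toℕ i × toℕ i < B + L) →
                    (∀ i → B ≤ toℕ i × toℕ i < B + L → T (isPrefix y (Row s row i))) →
                    HasRng s row y (rangeStart L B) L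
  hasRng-interval s row y B zero inside _ =
    (λ i → (λ ()) , (λ t → ⊥-elim (empty (inside i t)))) , λ _ → refl
    where
    empty : ∀ {k} → ¬ (B ≤ k × k < B + 0)
    empty {k} (B≤k , k<B) = <⇒≱ (subst (k <_) (+-identityʳ B) k<B) B≤k
  hasRng-interval s row y B (suc L) inside outside = (λ i → outside i , inside i) , λ ()

  module Block {σ} (s : Str σ) (π : Orderings σ) (row : Fin (length s) → Fin (length s))
               (sorted : ∀ i j → toℕ i < toℕ j → Row s row i ≺[ π ] Row s row j)
               (x : Str σ) (b ℓ : ℕ) (hasRng : HasRng s row x b ℓ) where

    n : ℕ
    n = length s

    prefixed : Fin n → Bool
    prefixed i = isPrefix x (Row s row i)

    key : Fin n → ℕ
    key i = nextRank π x (Row s row i)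

    precedes hits : ℕ → Fin n → Bool
    precedes v i = prefixed i ∧ (key i <ᵇ v)
    hits v i = prefixed i ∧ (key i ≡ᵇ v)

    rowsBelow rowsAt : ℕ → ℕ
    rowsBelow v = countBelow (extend (precedes v)) n
    rowsAt v = countBelow (extend (hits v)) n

    rowsBelow-zero : rowsBelow 0 ≡ 0
    rowsBelow-zero = countBelow-none _ n (extend-false (precedes 0) (λ i → ∧-false (prefixed i)))
      where
      ∧-false : ∀ p → p ∧ false ≡ false
      ∧-false true = refl
      ∧-false false = refl

    rowsBelow-suc : ∀ v → rowsBelow (suc v) ≡ rowsBelow v + rowsAt v
    rowsBelow-suc v = countBelow-+ _ _ _ n (extend-[+] (precedes (suc v)) (precedes v) (hits v) split)
      where
      split : ∀ i → [ precedes (suc v) i ] ≡ [ precedes v i ] + [ hits v i ]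
      split i with prefixed i
      ... | true = [<ᵇ-suc] (key i) v
      ... | false = refl

    block⇒ : ∀ i → T (prefixed i) → b ≤ toℕ i × toℕ i < b + ℓ
    block⇒ i = proj₂ (proj₁ hasRng i)

    ⇒block : ∀ i → b ≤ toℕ i → toℕ i < b + ℓ → T (prefixed i)
    ⇒block i b≤i i<b+ℓ = proj₁ (proj₁ hasRng i) (b≤i , i<b+ℓ)

    key-mono : ∀ i j → toℕ i ≤ toℕ j → T (prefixed i) → T (prefixed j) → key i ≤ key j
    key-mono i j i≤j xi xj with m≤n⇒m<n∨m≡n i≤j
    ... | inj₁ i<j = ≺-nextRank-mono π x (sorted i j i<j) xi xj
    ... | inj₂ i≡j rewrite toℕ-injective i≡j = ≤-refl

    precedes-above : ∀ v i → T (extend (precedes v) i) → b ≤ i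
    precedes-above v i t with i <? n
    ... | yes i<n = subst (b ≤_) (toℕ-fromℕ< i<n)
                      (proj₁ (block⇒ _ (proj₁ (to T-∧ (subst T (extend-fromℕ< (precedes v) i i<n) t)))))
    ... | no i≮n = ⊥-elim (subst T (extend-≥ (precedes v) i (≮⇒≥ i≮n)) t)

    precedes-down-closed : ∀ v i i′ → T (extend (precedes v) i′) → b ≤ i → i ≤ i′ → T (extend (precedes v) i)
    precedes-down-closed v i i′ t b≤i i≤i′ with i′ <? n
    ... | no i′≮n = ⊥-elim (subst T (extend-≥ (precedes v) i′ (≮⇒≥ i′≮n)) t)
    ... | yes i′<n = subst T (sym (extend-fromℕ< (precedes v) i i<n))
                       (from T-∧ (xI , <⇒<ᵇ (≤-<-trans keyI≤keyI′ (<ᵇ⇒< (key I′) v keyI′<v))))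
      where
      i<n : i < n
      i<n = ≤-<-trans i≤i′ i′<n
      I I′ : Fin n
      I = fromℕ< i<n
      I′ = fromℕ< i′<n
      xI′ : T (prefixed I′)
      xI′ = proj₁ (to T-∧ (subst T (extend-fromℕ< (precedes v) i′ i′<n) t))
      keyI′<v : T (key I′ <ᵇ v)
      keyI′<v = proj₂ (to T-∧ (subst T (extend-fromℕ< (precedes v) i′ i′<n) t))
      I≤I′ : toℕ I ≤ toℕ I′
      I≤I′ = subst₂ _≤_ (sym (toℕ-fromℕ< i<n)) (sym (toℕ-fromℕ< i′<n)) i≤i′
      xI : T (prefixed I)
      xI = ⇒block I (subst (b ≤_) (sym (toℕ-fromℕ< i<n)) b≤i) (≤-<-trans I≤I′ (proj₂ (block⇒ I′ xI′)))
      keyI≤keyI′ : key I ≤ key I′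
      keyI≤keyI′ = key-mono I I′ I≤I′ xI xI′

    precedes-interval : ∀ v → IntervalBelow (extend (precedes v)) b n (rowsBelow v)
    precedes-interval v = proj₁ (interval-count _ b (precedes-above v) (precedes-down-closed v) n)

    precedes⇒interval : ∀ v i → T (precedes v i) → b ≤ toℕ i × toℕ i < b + rowsBelow v
    precedes⇒interval v i t =
      proj₁ (precedes-interval v (toℕ i) (toℕ<n i)) (subst T (sym (extend-toℕ (precedes v) i)) t)

    interval⇒precedes : ∀ v i → b ≤ toℕ i → toℕ i < b + rowsBelow v → T (precedes v i)
    interval⇒precedes v i b≤i i<b+N =
      subst T (extend-toℕ (precedes v) i) (proj₂ (precedes-interval v (toℕ i) (toℕ<n i)) (b≤i , i<b+N))

    hits⇒interval : ∀ v i → T (hits v i) → b + rowsBelow v ≤ toℕ i × toℕ i < b + rowsBelow v + rowsAt v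
    hits⇒interval v i t = ≮⇒≥ not-before , subst (toℕ i <_) end≡ (proj₂ (precedes⇒interval (suc v) i precedes-suc))
      where
      xi : T (prefixed i)
      xi = proj₁ (to T-∧ t)
      key≡v : key i ≡ v
      key≡v = ≡ᵇ⇒≡ (key i) v (proj₂ (to T-∧ t))
      precedes-suc : T (precedes (suc v) i)
      precedes-suc = from T-∧ (xi , <⇒<ᵇ (≤-reflexive (cong suc key≡v)))
      not-before : ¬ (toℕ i < b + rowsBelow v)
      not-before i<b+N = <-irrefl key≡v (<ᵇ⇒< (key i) v (proj₂ (to T-∧
        (interval⇒precedes v i (proj₁ (precedes⇒interval (suc v) i precedes-suc)) i<b+N))))
      end≡ : b + rowsBelow (suc v) ≡ b + rowsBelow v + rowsAt v
      end≡ = trans (cong (b +_) (rowsBelow-suc v)) (sym (+-assoc b _ _))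

    interval⇒hits : ∀ v i → b + rowsBelow v ≤ toℕ i → toℕ i < b + rowsBelow v + rowsAt v → T (hits v i)
    interval⇒hits v i N≤i i<N+C = from T-∧ (xi , ≡⇒≡ᵇ (key i) v (≤-antisym (≤-pred key<1+v) (≮⇒≥ key≮v)))
      where
      precedes-suc : T (precedes (suc v) i)
      precedes-suc = interval⇒precedes (suc v) i (≤-trans (m≤m+n b (rowsBelow v)) N≤i)
        (subst (toℕ i <_) (trans (+-assoc b _ _) (cong (b +_) (sym (rowsBelow-suc v)))) i<N+C)
      xi : T (prefixed i)
      xi = proj₁ (to T-∧ precedes-suc)
      key<1+v : key i < suc v
      key<1+v = <ᵇ⇒< (key i) (suc v) (proj₂ (to T-∧ precedes-suc))
      key≮v : ¬ (key i < v)
      key≮v key<v = <⇒≱ (proj₂ (precedes⇒interval v i (from T-∧ (xi , <⇒<ᵇ key<v)))) N≤i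

    private
      ρ : Permutation′ σ
      ρ = π x

      isNext≡rankOf : ∀ c m → isNext c m ≡ (rankOf π x m ≡ᵇ rank ρ c)
      isNext≡rankOf c nothing with σ ≡ᵇ rank ρ c in e
      ... | false = refl
      ... | true = ⊥-elim (<⇒≢ (rank< ρ c) (sym (≡ᵇ⇒≡ σ (rank ρ c) (subst T (sym e) tt))))
      isNext≡rankOf c (just d) with c ≟ᶠ d | rank ρ d ≡ᵇ rank ρ c in e
      ... | yes _ | true = refl
      ... | no _ | false = refl
      ... | yes refl | false = ⊥-elim (subst T e (≡⇒≡ᵇ (rank ρ d) (rank ρ d) refl))
      ... | no c≢d | true = ⊥-elim (c≢d (sym (rank-injective ρ d c (≡ᵇ⇒≡ (rank ρ d) (rank ρ c) (subst T (sym e) tt)))))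

    isPrefix-∷ʳ≡hits : ∀ c i → isPrefix (x ++ c ∷ []) (Row s row i) ≡ hits (rank ρ c) i
    isPrefix-∷ʳ≡hits c i =
      trans (isPrefix-∷ʳ x (Row s row i) c) (cong (prefixed i ∧_) (isNext≡rankOf c (nth (Row s row i) (length x))))

    countRows-∷ʳ : ∀ c → countRows s row (x ++ c ∷ []) ≡ rowsAt (rank ρ c)
    countRows-∷ʳ c = trans (length-filter-allFin n (λ i → isPrefix (x ++ c ∷ []) (Row s row i)))
      (countBelow-cong _ _ n (λ i _ → extend-cong _ _ (isPrefix-∷ʳ≡hits c) i))

    extension-range : ∀ c → HasRng s row (x ++ c ∷ [])
      (rangeStart (countRows s row (x ++ c ∷ [])) (b + rowsBelow (rank ρ c))) (countRows s row (x ++ c ∷ []))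
    extension-range c = hasRng-interval s row (x ++ c ∷ []) start _ inside outside
      where
      start : ℕ
      start = b + rowsBelow (rank ρ c)
      inside : ∀ i → T (isPrefix (x ++ c ∷ []) (Row s row i)) →
               start ≤ toℕ i × toℕ i < start + countRows s row (x ++ c ∷ [])
      inside i t rewrite countRows-∷ʳ c = hits⇒interval (rank ρ c) i (subst T (isPrefix-∷ʳ≡hits c i) t)
      outside : ∀ i → start ≤ toℕ i × toℕ i < start + countRows s row (x ++ c ∷ []) →
                T (isPrefix (x ++ c ∷ []) (Row s row i))
      outside i (N≤i , i<N+L) rewrite countRows-∷ʳ c | isPrefix-∷ʳ≡hits c i = interval⇒hits (rank ρ c) i N≤i i<N+L

    prefixSums≡rowsBelow : ∀ (ℓs : Fin σ → ℕ) → (∀ c → ℓs c ≡ countRows s row (x ++ c ∷ [])) →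
                           ∀ v → v ≤ σ → prefixSums (byRank ρ ℓs) v ≡ rowsBelow v
    prefixSums≡rowsBelow ℓs ℓs≡ zero _ = sym rowsBelow-zero
    prefixSums≡rowsBelow ℓs ℓs≡ (suc v) v<σ = begin
      prefixSums (byRank ρ ℓs) v + byRank ρ ℓs v  ≡⟨ cong₂ _+_ (prefixSums≡rowsBelow ℓs ℓs≡ v (<⇒≤ v<σ)) byRank≡rowsAt ⟩
      rowsBelow v + rowsAt v                      ≡⟨ rowsBelow-suc v ⟨
      rowsBelow (suc v)                           ∎
      where
      open ≡-Reasoning
      byRank≡rowsAt : byRank ρ ℓs v ≡ rowsAt v
      byRank≡rowsAt with rank-surjective ρ v v<σ
      ... | c , refl = trans (byRank-rank ρ ℓs c) (trans (ℓs≡ c) (countRows-∷ʳ c))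

  extension-ranges : ∀ {σ} (s : Str σ) (π : Orderings σ) (row : Fin (length s) → Fin (length s)) →
    IsMstar π s row → ∀ x b ℓs → HasRngx s row x b ℓs → ∀ c →
    HasRng s row (x ++ c ∷ []) (rangeStart (ℓs c) (b + prefixSums (byRank (π x) ℓs) (rank (π x) c))) (ℓs c)
  extension-ranges s π row (_ , sorted) x b ℓs ((ℓ , hasRng) , ℓs≡) c =
    subst₂ (λ L N → HasRng s row (x ++ c ∷ []) (rangeStart L (b + N)) L)
           (sym (ℓs≡ c)) (sym (prefixSums≡rowsBelow ℓs ℓs≡ (rank (π x) c) (<⇒≤ (rank< (π x) c))))
           (extension-range c)
    where open Block s π row sorted x b ℓ hasRng

module Program where

  open Machine
  open Extension using (rank; rank<; rank-injective; rank-surjective; byRank; byRank-rank; prefixSums; rangeStart)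
  open import Data.Nat
  open import Data.Nat.Properties
  open import Data.Nat.Tactic.RingSolver using (solve-∀)
  open import Data.Bool using (true; false; T; if_then_else_)
  open import Data.Product using (Σ; _×_; _,_; proj₁; proj₂)
  open import Data.List using ([]; _∷_; length)
  open import Data.Fin using (Fin; toℕ; fromℕ<)
  open import Data.Fin.Properties using (fromℕ<-cong; toℕ-fromℕ<; fromℕ<-toℕ; toℕ<n)
  open import Data.Fin.Permutation using (Permutation′)
  open import Relation.Binary.PropositionalEquality hiding (J)
  open import Relation.Nullary using (yes; no)
  open import Data.Empty using (⊥; ⊥-elim)

  lit< : ∀ r {k} {_ : T (r <ᵇ k)} → r < k
  lit< r {k} {r<k} = <ᵇ⇒< r k r<k

  quad : ℕ → ℕ
  quad s = (s + s) + (s + s)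

  1≢quad : ∀ s → 1 ≢ quad s
  1≢quad zero ()
  1≢quad (suc t) e with suc-injective e
  ... | e′ = 0≢1+n (trans e′ (+-suc (t + suc t) (t + suc t)))

  quad≡0⇒≡0 : ∀ s → 0 ≡ quad s → s ≡ 0
  quad≡0⇒≡0 zero e = refl
  quad≡0⇒≡0 (suc s) ()

  quad≡4* : ∀ s → (s + s) + (s + s) ≡ 4 * s
  quad≡4* = solve-∀

  quad≥4 : ∀ s → 1 ≤ s → 4 ≤ quad s
  quad≥4 s le = subst (4 ≤_) (sym (quad≡4* s)) (*-monoʳ-≤ 4 le)

  2≢quad : ∀ s → 2 ≢ quad s
  2≢quad zero ()
  2≢quad (suc t) e = <⇒≢ (≤-trans (lit< 2) (quad≥4 (suc t) z<s)) e

  <⇒≢k+ : ∀ {a x} k → a < x → a ≢ k + x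
  <⇒≢k+ {a} {x} k lt e = <⇒≢ (≤-trans lt (m≤n+m x k)) e

  ≢suc+ : ∀ x k → x ≢ suc k + x
  ≢suc+ x k e = <⇒≢ (≤-trans (n<1+n x) (s≤s (m≤n+m x k))) e

  3≤⇒≢2 : ∀ {a} → 3 ≤ a → a ≢ 2
  3≤⇒≢2 (s≤s (s≤s (s≤s _))) ()

  3≤⇒≢1 : ∀ {a} → 3 ≤ a → a ≢ 1
  3≤⇒≢1 (s≤s (s≤s (s≤s _))) ()

  <12⇒≢12+ : ∀ {r} x → r < 12 → r ≢ 12 + x
  <12⇒≢12+ {r} x lt e = <⇒≢ (≤-trans lt (m≤m+n 12 x)) e

  suc≡∸ : ∀ {n y c} → suc n ≡ y ∸ c → n ≡ y ∸ suc c
  suc≡∸ {n} {y} {c} e = trans (cong pred e) (pred[m∸n]≡m∸[1+n] y c)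

  suc≡∸⇒< : ∀ {n y c} → suc n ≡ y ∸ c → c < y
  suc≡∸⇒< {n} {y} {c} e = m∸n≢0⇒n<m (λ z → 0≢1+n (trans (sym z) (sym e)))

  0≡∸⇒≤ : ∀ {y c} → 0 ≡ y ∸ c → y ≤ c
  0≡∸⇒≤ {y} {c} e = m∸n≡0⇒m≤n (sym e)

  +1≡suc : ∀ x → x + 1 ≡ suc x
  +1≡suc x = +-comm x 1

  2+2s≤ : ∀ s c → 3 ≤ c → quad s ≤ c → 2 + (s + s) ≤ c
  2+2s≤ zero c c3 _ = ≤-trans (n≤1+n 2) c3
  2+2s≤ (suc t) c _ qc = ≤-trans (+-monoˡ-≤ (suc t + suc t) (s≤s (subst (1 ≤_) (sym (+-suc t t)) z<s))) qc

  quad-suc : ∀ c → ((c + c) + (c + c)) + 4 ≡ (suc c + suc c) + (suc c + suc c)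
  quad-suc = solve-∀

  quad-mono-< : ∀ {a c} → a < c → quad a < quad c
  quad-mono-< {a} {c} lt rewrite quad≡4* a | quad≡4* c = *-monoʳ-< 4 lt

  2+2s≤quad : ∀ s → 1 ≤ s → 2 + (s + s) ≤ quad s
  2+2s≤quad s le = 2+2s≤ s (quad s) (≤-trans (n≤1+n 3) (quad≥4 s le)) ≤-refl

  saved<table : ∀ {a y z} → a < y → 12 + (a + y) < 12 + ((y + y) + z)
  saved<table {a} {y} {z} lt = +-monoʳ-< 12 (≤-trans (+-monoˡ-< y lt) (m≤m+n (y + y) z))

  double-< : ∀ {t j} → t < j → t + t < j + j
  double-< lt = +-mono-< lt lt

  suc-double-< : ∀ {t j} → t < j → suc (t + t) < j + j
  suc-double-< {t} {j} lt = ≤-trans (≤-reflexive (cong suc (sym (+-suc t t)))) (+-mono-≤ lt lt)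

  out≡outB : ∀ s j → (2 + (s + s)) + (j + j) ≡ 2 * s + 2 + 2 * j
  out≡outB = solve-∀

  out≡outL : ∀ s j → (2 + (s + s)) + suc (j + j) ≡ 2 * s + 3 + 2 * j
  out≡outL = solve-∀

  t<s+s⇒1≤s : ∀ s {t} → t < s + s → 1 ≤ s
  t<s+s⇒1≤s zero ()
  t<s+s⇒1≤s (suc s) _ = z<s

  -- The running times of the phases in program order; the copy loop makes x = 4σ − 3 rounds.
  stepCount : ℕ → ℕ → ℕ
  stepCount x s = 3 + (7 + (3 + ((x * 7 + 2) + (4 + ((s * 4 + 2) + (8 + ((s * 8 + 2) + (6 + ((s * 6 + 2)
                + (5 + ((s * 14 + 2) + (6 + ((s + s) * 7 + 2)))))))))))))

  stepCount≤ : ∀ x s → x ≤ quad s → stepCount x s ≤ 100 * s + 100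
  stepCount≤ x s x≤4s = begin
    stepCount x s          ≡⟨ linear x s ⟩
    54 + (x * 7 + 46 * s)  ≤⟨ +-monoʳ-≤ 54 (+-monoˡ-≤ (46 * s) (*-monoˡ-≤ 7 (≤-trans x≤4s (≤-reflexive (quad≡4* s))))) ⟩
    54 + (4 * s * 7 + 46 * s) ≡⟨ collect s ⟩
    74 * s + 54            ≤⟨ +-mono-≤ (*-monoˡ-≤ s (m≤m+n 74 26)) (m≤m+n 54 46) ⟩
    100 * s + 100          ∎
    where
    open ≤-Reasoning
    linear : ∀ x s → 3 + (7 + (3 + ((x * 7 + 2) + (4 + ((s * 4 + 2) + (8 + ((s * 8 + 2) + (6 + ((s * 6 + 2)
                    + (5 + ((s * 14 + 2) + (6 + ((s + s) * 7 + 2))))))))))))) ≡ 54 + (x * 7 + 46 * s)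
    linear = solve-∀
    collect : ∀ s → 54 + (4 * s * 7 + 46 * s) ≡ 74 * s + 54
    collect = solve-∀

  -- With Y = 4σ: registers 0–11 are scratch and overlap the input, so input register a is first
  -- copied to saved a = 12 + a + Y; table r = 12 + 2Y + r receives ℓ of the symbol of rank r and is
  -- then replaced by b plus the sum below r; the answers are assembled at staged 0 … staged (2σ − 1)
  -- and only copied to outB, outL at the end, as these may overlap the scratch registers.
  -- The instructions at pc 70 and 71 are no-ops making both branches of the test at pc 69 equally long.
  prog : Program
  prog =
    add 0 0 0 ∷ add 0 0 0 ∷ store 0 2 ∷ const 2 13 ∷ add 2 2 0 ∷            -- 0-4
    store 2 1 ∷ load 1 0 ∷ const 2 14 ∷ add 2 2 0 ∷ store 2 1 ∷              -- 5-9
    const 1 3 ∷ const 2 15 ∷ add 2 2 0 ∷ jlt 1 0 15 ∷ jmp 21 ∷               -- 10-14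
    load 3 1 ∷ store 2 3 ∷ const 3 1 ∷ add 1 1 3 ∷ add 2 2 3 ∷               -- 15-19
    jmp 13 ∷ const 1 0 ∷ const 2 0 ∷ const 3 1 ∷ const 4 4 ∷                 -- 20-24
    jlt 2 0 27 ∷ jmp 30 ∷ add 1 1 3 ∷ add 2 2 4 ∷ jmp 25 ∷                   -- 25-29
    const 2 1 ∷ const 3 14 ∷ add 3 3 0 ∷ add 4 3 1 ∷ add 5 3 1 ∷             -- 30-34
    const 6 12 ∷ add 6 6 0 ∷ add 6 6 0 ∷ jlt 3 5 40 ∷ jmp 47 ∷               -- 35-39
    load 7 4 ∷ add 7 6 7 ∷ load 8 3 ∷ add 3 3 2 ∷ add 4 4 2 ∷                -- 40-44
    store 7 8 ∷ jmp 38 ∷ const 3 0 ∷ add 3 3 6 ∷ add 5 6 1 ∷                 -- 45-49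
    const 7 13 ∷ add 7 7 0 ∷ load 8 7 ∷ jlt 3 5 55 ∷ jmp 60 ∷                -- 50-54
    load 7 3 ∷ store 3 8 ∷ add 8 8 7 ∷ add 3 3 2 ∷ jmp 53 ∷                  -- 55-59
    const 3 14 ∷ add 3 3 0 ∷ add 4 3 1 ∷ add 5 3 1 ∷ add 9 6 1 ∷             -- 60-64
    jlt 3 5 67 ∷ jmp 83 ∷ load 7 3 ∷ const 8 0 ∷ jlt 8 7 73 ∷                -- 65-69
    const 10 0 ∷ const 10 0 ∷ jmp 76 ∷ load 8 4 ∷ add 8 6 8 ∷                -- 70-74
    load 8 8 ∷ add 3 3 2 ∷ add 4 4 2 ∷ add 11 9 2 ∷ store 9 8 ∷              -- 75-79
    store 11 7 ∷ add 9 11 2 ∷ jmp 65 ∷ const 2 2 ∷ add 2 2 0 ∷               -- 80-84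
    add 0 1 1 ∷ const 3 2 ∷ add 0 3 0 ∷ add 1 6 1 ∷ jlt 0 2 91 ∷             -- 85-89
    jmp 97 ∷ load 3 1 ∷ store 0 3 ∷ const 3 1 ∷ add 0 0 3 ∷                  -- 90-94
    add 1 1 3 ∷ jmp 89 ∷ []                                                  -- 95-96

  open Hoare prog

  module Correctness (σ b : ℕ) (ℓs : Fin σ → ℕ) (ρ : Permutation′ σ) where
    rk : Fin σ → ℕ
    rk = rank ρ
    Lv : ℕ → ℕ
    Lv = byRank ρ ℓs
    input : Mem
    input = initMem σ b ℓs rk

    Y : ℕ
    Y = quad σ

    saved : ℕ → ℕ
    saved a = 12 + (a + Y)

    tableBase : ℕ
    tableBase = 12 + (Y + Y)

    table : ℕ → ℕ
    table r = tableBase + r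

    staged : ℕ → ℕ
    staged t = (tableBase + σ) + t

    input-ℓ : ∀ j (p : j < σ) → input (2 + j) ≡ ℓs (fromℕ< p)
    input-ℓ j p with j <? σ
    ... | yes q = refl
    ... | no ¬q = ⊥-elim (¬q p)

    input-rank : ∀ j (p : j < σ) → input (2 + (σ + j)) ≡ rk (fromℕ< p)
    input-rank j p with σ + j <? σ
    ... | yes q = ⊥-elim (<⇒≱ q (m≤m+n σ j))
    ... | no _ with (σ + j) ∸ σ <? σ
    ...   | yes q = cong rk (fromℕ<-cong _ _ (m+n∸m≡n σ j) q p)
    ...   | no ¬q = ⊥-elim (¬q (subst (_< σ) (sym (m+n∸m≡n σ j)) p))

    input-beyond : ∀ k → σ + σ ≤ k → input (2 + k) ≡ 0
    input-beyond k le with k <? σ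
    ... | yes q = ⊥-elim (<⇒≱ q (≤-trans (m≤m+n σ σ) le))
    ... | no _ with k ∸ σ <? σ
    ...   | yes q = ⊥-elim (<⇒≱ q (subst (_≤ k ∸ σ) (m+n∸m≡n σ σ) (∸-monoˡ-≤ σ le)))
    ...   | no _ = refl


    after : Instr → Mem → Mem
    after i m = mem (exec i 0 m)

    record Stashed (m : Mem) : Set where
      field
        r0 : m 0 ≡ Y
        r1 : m 1 ≡ b
        atY : m Y ≡ input 2
        untouched : ∀ a → 3 ≤ a → a < Y → m a ≡ input a

    m₁ m₂ m₃ : Mem
    m₁ = upd input 0 (σ + σ)
    m₂ = upd m₁ 0 Y
    m₃ = upd m₂ Y (input 2)

    stash-result : Stashed m₃
    stash-result = record { r0 = r0 ; r1 = upd-other m₂ Y _ 1 (1≢quad σ) ; atY = upd-same m₂ Y _ Y refl ; untouched = untouched }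
      where
      r0 : m₃ 0 ≡ Y
      r0 with 0 ≟ Y
      ... | yes e = trans (upd-same m₂ Y _ 0 e) (trans (input-beyond 0 (subst (λ s → s + s ≤ 0) (sym (quad≡0⇒≡0 σ e)) z≤n)) e)
      ... | no ne = upd-other m₂ Y _ 0 ne
      untouched : ∀ a → 3 ≤ a → a < Y → m₃ a ≡ input a
      untouched a le lt = trans (upd-other m₂ Y _ a (<⇒≢ lt)) (trans (upd-other m₁ 0 _ a (λ e → case e le)) (upd-other input 0 _ a (λ e → case e le)))
        where
        case : a ≡ 0 → 3 ≤ a → ⊥
        case refl ()

    record LowSaved (m : Mem) : Set where
      field
        r0 : m 0 ≡ Y
        saved-b : m (saved 1) ≡ b
        saved-ℓ₀ : m (saved 2) ≡ input 2
        untouched : ∀ a → 3 ≤ a → a < Y → m a ≡ input a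

    save-low : Triple (At 3 Stashed) 7 (At 10 LowSaved)
    save-low .holds ⟨ p , m ⟩ (refl , F) = refl , record { r0 = Stashed.r0 F ; saved-b = saved-b ; saved-ℓ₀ = saved-ℓ₀ ; untouched = untouched }
      where
      open Stashed F using (r0; r1; atY)
      n1 n2 n3 n4 n5 n6 n7 : Mem
      n1 = after (const 2 13) m
      n2 = after (add 2 2 0) n1
      n3 = after (store 2 1) n2
      n4 = after (load 1 0) n3
      n5 = after (const 2 14) n4
      n6 = after (add 2 2 0) n5
      n7 = after (store 2 1) n6
      ne13 : 13 + Y ≢ 14 + m 0
      ne13 e rewrite r0 = ≢suc+ (13 + Y) 0 e
      saved-b : n7 (13 + Y) ≡ b
      saved-b = trans (upd-other n6 (14 + m 0) (n6 1) (13 + Y) ne13)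
                 (trans (upd-same n2 (13 + m 0) (n2 1) (13 + Y) (cong (13 +_) (sym r0))) r1)
      saved-ℓ₀ : n7 (14 + Y) ≡ input 2
      saved-ℓ₀ = trans (upd-same n6 (14 + m 0) (n6 1) (14 + Y) (cong (14 +_) (sym r0)))
           (trans (upd-other n2 (13 + m 0) (n2 1) (m 0) (λ e → ≢suc+ (m 0) 12 e))
           (trans (upd-other n1 2 _ (m 0) (λ e → 2≢quad σ (trans (sym e) r0)))
           (trans (upd-other m 2 13 (m 0) (λ e → 2≢quad σ (trans (sym e) r0)))
           (trans (cong m r0) atY))))
      untouched : ∀ a → 3 ≤ a → a < Y → n7 a ≡ input a
      untouched a le lt = trans (upd-other n6 (14 + m 0) _ a (subst (λ z → a ≢ 14 + z) (sym r0) (<⇒≢k+ 14 lt)))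
                 (trans (upd-other n5 2 _ a ne2) (trans (upd-other n4 2 _ a ne2)
                 (trans (upd-other n3 1 _ a ne1)
                 (trans (upd-other n2 (13 + m 0) _ a (subst (λ z → a ≢ 13 + z) (sym r0) (<⇒≢k+ 13 lt)))
                 (trans (upd-other n1 2 _ a ne2) (trans (upd-other m 2 _ a ne2) (Stashed.untouched F a le lt)))))))
        where
        ne2 : a ≢ 2
        ne2 = 3≤⇒≢2 le
        ne1 : a ≢ 1
        ne1 = 3≤⇒≢1 le

    saved-suc : ∀ c → saved c + 1 ≡ saved (suc c)
    saved-suc c = cong (12 +_) (+1≡suc (c + Y))

    saved-injective : ∀ {a c} → saved a ≡ saved c → a ≡ c
    saved-injective {a} {c} e = +-cancelʳ-≡ Y a c (+-cancelˡ-≡ 12 _ _ e)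

    record CopyInv (n : ℕ) (m : Mem) : Set where
      field
        c : ℕ
        remaining : n ≡ Y ∸ c
        c3 : 3 ≤ c
        r0 : m 0 ≡ Y
        r1 : m 1 ≡ c
        r2 : m 2 ≡ saved c
        savedOK : ∀ a → 0 < a → a < c → m (saved a) ≡ input a
        untouched : ∀ a → c ≤ a → a < Y → m a ≡ input a

    copy-init : Triple (At 10 LowSaved) 3 (At 13 (CopyInv (Y ∸ 3)))
    copy-init .holds ⟨ p , m ⟩ (refl , F) = refl , record
      { c = 3 ; remaining = refl ; c3 = ≤-refl ; r0 = r0 ; r1 = refl ; r2 = cong (15 +_) r0
      ; savedOK = savedOK ; untouched = untouched }
      where
      open LowSaved F using (r0; saved-b; saved-ℓ₀)
      s1 s2 s3 : Mem
      s1 = after (const 1 3) m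
      s2 = after (const 2 15) s1
      s3 = after (add 2 2 0) s2
      savedOK : ∀ a → 0 < a → a < 3 → s3 (saved a) ≡ input a
      savedOK (suc zero) _ _ = saved-b
      savedOK (suc (suc zero)) _ _ = saved-ℓ₀
      savedOK (suc (suc (suc a))) _ (s≤s (s≤s (s≤s ())))
      untouched : ∀ a → 3 ≤ a → a < Y → s3 a ≡ input a
      untouched a le lt = trans (upd-other s2 2 _ a (3≤⇒≢2 le)) (trans (upd-other s1 2 _ a (3≤⇒≢2 le))
                   (trans (upd-other m 1 _ a (3≤⇒≢1 le)) (LowSaved.untouched F a le lt)))

    copy-step : ∀ n → Triple (At 13 (CopyInv (suc n))) (suc 6) (At 13 (CopyInv n))
    copy-step n .holds ⟨ p , m ⟩ (refl , I) =
      subst (At 13 (CopyInv n)) (sym (jlt-taken {k = 6} {L = 13} {a = 1} {b = 0} {t = 15} {m = m} refl cond))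
        (refl , record { c = suc c ; remaining = suc≡∸ {y = Y} {c = c} remaining ; c3 = ≤-trans c3 (n≤1+n c)
          ; r0 = trans (upd-other k1 (m 2) _ 0 (ne 0 z<s)) r0
          ; r1 = trans (cong (_+ 1) (trans (upd-other k1 (m 2) _ 1 (ne 1 (lit< 1))) r1)) (+1≡suc c)
          ; r2 = trans (cong (_+ 1) (trans (upd-other k1 (m 2) _ 2 (ne 2 (lit< 2))) r2)) (saved-suc c)
          ; savedOK = savedOK′ ; untouched = untouched′ })
      where
      open CopyInv I
      cond : (m 1 <ᵇ m 0) ≡ true
      cond rewrite r1 | r0 = <⇒<ᵇ-true (suc≡∸⇒< {y = Y} {c = c} remaining)
      k1 k2 k3 k4 k5 : Mem
      k1 = after (load 3 1) m
      k2 = after (store 2 3) k1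
      k3 = after (const 3 1) k2
      k4 = after (add 1 1 3) k3
      k5 = after (add 2 2 3) k4
      ne : ∀ r → r < 12 → r ≢ m 2
      ne r lt e = <12⇒≢12+ (c + Y) lt (trans e r2)
      savedOK′ : ∀ a → 0 < a → a < suc c → k5 (saved a) ≡ input a
      savedOK′ a pos lt with a ≟ c
      ... | yes refl = trans (upd-same k1 (m 2) _ (saved a) (sym r2))
                       (trans (cong m r1) (untouched c ≤-refl (suc≡∸⇒< {y = Y} {c = c} remaining)))
      ... | no a≢c = trans (upd-other k1 (m 2) _ (saved a) (λ e → a≢c (saved-injective (trans e r2))))
                       (savedOK a pos (≤∧≢⇒< (≤-pred lt) a≢c))
      untouched′ : ∀ a → suc c ≤ a → a < Y → k5 a ≡ input a
      untouched′ a le lt = trans (upd-other k4 2 _ a (3≤⇒≢2 le3)) (trans (upd-other k3 1 _ a (3≤⇒≢1 le3))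
                    (trans (upd-other k2 3 _ a ne3)
                    (trans (upd-other k1 (m 2) _ a (λ e → <⇒≢k+ 12 (≤-trans lt (m≤n+m Y c)) (trans e r2)))
                    (trans (upd-other m 3 _ a ne3) (untouched a (≤-trans (n≤1+n c) le) lt)))))
        where
        le3 : 3 ≤ a
        le3 = ≤-trans c3 (≤-trans (n≤1+n c) le)
        ne3 : a ≢ 3
        ne3 e = <⇒≢ (≤-trans (s≤s c3) le) (sym e)

    record Copied (m : Mem) : Set where
      field
        r0 : m 0 ≡ Y
        savedOK : ∀ a → 0 < a → a < 2 + (σ + σ) → m (saved a) ≡ input a

    copy-exit : Triple (At 13 (CopyInv 0)) (suc 1) (At 21 Copied)
    copy-exit .holds ⟨ p , m ⟩ (refl , I) =
      subst (At 21 Copied) (sym (jlt-skipped {k = 1} {L = 13} {a = 1} {b = 0} {t = 15} {m = m} refl cond))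
        (refl , record { r0 = r0 ; savedOK = λ a pos lt → savedOK a pos (≤-trans lt (2+2s≤ σ c c3 (0≡∸⇒≤ {y = Y} {c = c} remaining))) })
      where
      open CopyInv I
      cond : (m 1 <ᵇ m 0) ≡ false
      cond rewrite r1 | r0 = ≥⇒<ᵇ-false (0≡∸⇒≤ {y = Y} {c = c} remaining)

    copy : ∀ n → Triple (At 13 (CopyInv n)) (n * suc 6 + suc 1) (At 21 Copied)
    copy = loop (λ n → At 13 (CopyInv n)) (At 21 Copied) (suc 6) (suc 1) copy-step copy-exit

    SavedInput : Mem → Set
    SavedInput m = ∀ a → 0 < a → a < 2 + (σ + σ) → m (saved a) ≡ input a

    upd-high : ∀ m X V r z → r < 12 → X ≡ 12 + z → upd m X V r ≡ m r
    upd-high m X V r z lt e = upd-other m X V r (λ e′ → <12⇒≢12+ z lt (trans e′ e))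

    record RecountInv (n : ℕ) (m : Mem) : Set where
      field
        c : ℕ
        remaining : c + n ≡ σ
        r0 : m 0 ≡ Y
        r1 : m 1 ≡ c
        r2 : m 2 ≡ quad c
        r3 : m 3 ≡ 1
        r4 : m 4 ≡ 4
        savedOK : SavedInput m

    recount-init : Triple (At 21 Copied) 4 (At 25 (RecountInv σ))
    recount-init .holds ⟨ p , m ⟩ (refl , F) = refl , record
      { c = 0 ; remaining = refl ; r0 = Copied.r0 F ; r1 = refl ; r2 = refl ; r3 = refl ; r4 = refl ; savedOK = Copied.savedOK F }

    recount-step : ∀ n → Triple (At 25 (RecountInv (suc n))) (suc 3) (At 25 (RecountInv n))
    recount-step n .holds ⟨ p , m ⟩ (refl , I) =
      subst (At 25 (RecountInv n)) (sym (jlt-taken {k = 3} {L = 25} {a = 2} {b = 0} {t = 27} {m = m} refl cond))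
        (refl , record { c = suc c ; remaining = trans (sym (+-suc c n)) remaining ; r0 = r0
          ; r1 = trans (cong₂ _+_ r1 r3) (+1≡suc c)
          ; r2 = trans (cong₂ _+_ r2 r4) (quad-suc c) ; r3 = r3 ; r4 = r4 ; savedOK = savedOK })
      where
      open RecountInv I
      cond : (m 2 <ᵇ m 0) ≡ true
      cond rewrite r2 | r0 = <⇒<ᵇ-true (quad-mono-< (subst (c <_) remaining (m<m+n c z<s)))

    record Recounted (m : Mem) : Set where
      field
        r0 : m 0 ≡ Y
        r1 : m 1 ≡ σ
        savedOK : SavedInput m

    recount-exit : Triple (At 25 (RecountInv 0)) (suc 1) (At 30 Recounted)
    recount-exit .holds ⟨ p , m ⟩ (refl , I) =
      subst (At 30 Recounted) (sym (jlt-skipped {k = 1} {L = 25} {a = 2} {b = 0} {t = 27} {m = m} refl cond))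
        (refl , record { r0 = r0 ; r1 = trans r1 cσ ; savedOK = savedOK })
      where
      open RecountInv I
      cσ : c ≡ σ
      cσ = trans (sym (+-identityʳ c)) remaining
      cond : (m 2 <ᵇ m 0) ≡ false
      cond rewrite r2 | r0 | cσ = ≥⇒<ᵇ-false {x = Y} ≤-refl

    recount : ∀ n → Triple (At 25 (RecountInv n)) (n * suc 3 + suc 1) (At 30 Recounted)
    recount = loop (λ n → At 25 (RecountInv n)) (At 30 Recounted) (suc 3) (suc 1) recount-step recount-exit

    record ScatterInv (n : ℕ) (m : Mem) : Set where
      field
        j : ℕ
        remaining : j + n ≡ σ
        r0 : m 0 ≡ Y
        r1 : m 1 ≡ σ
        r2 : m 2 ≡ 1
        r3 : m 3 ≡ saved (2 + j)
        r4 : m 4 ≡ saved (2 + (σ + j))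
        r5 : m 5 ≡ saved (2 + σ)
        r6 : m 6 ≡ tableBase
        savedOK : SavedInput m
        tableOK : ∀ (J : Fin σ) → toℕ J < j → m (table (rk J)) ≡ ℓs J

    scatter-init : Triple (At 30 Recounted) 8 (At 38 (ScatterInv σ))
    scatter-init .holds ⟨ p , m ⟩ (refl , F) = refl , record
      { j = 0 ; remaining = refl ; r0 = r0 ; r1 = r1 ; r2 = refl ; r3 = cong (14 +_) r0
      ; r4 = trans (cong₂ (λ u v → (14 + u) + v) r0 r1)
                   (cong (14 +_) (trans (+-comm Y σ) (cong (_+ Y) (sym (+-identityʳ σ)))))
      ; r5 = trans (cong₂ (λ u v → (14 + u) + v) r0 r1) (cong (14 +_) (+-comm Y σ))
      ; r6 = cong (λ u → (12 + u) + u) r0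
      ; savedOK = savedOK ; tableOK = λ J () }
      where open Recounted F

    saved≢table : ∀ a r → a < Y → saved a ≢ table r
    saved≢table a r lt e = <⇒≢ (saved<table {a} {Y} {r} lt) e

    table-injective : ∀ {r r′} → table r ≡ table r′ → r ≡ r′
    table-injective {r} {r′} e = +-cancelˡ-≡ tableBase r r′ e

    scatter-step : ∀ n → Triple (At 38 (ScatterInv (suc n))) (suc 7) (At 38 (ScatterInv n))
    scatter-step n .holds ⟨ p , m ⟩ (refl , I) =
      subst (At 38 (ScatterInv n)) (sym (jlt-taken {k = 7} {L = 38} {a = 3} {b = 5} {t = 40} {m = m} refl cond))
        (refl , record { j = suc j ; remaining = trans (sym (+-suc j n)) remaining
          ; r0 = trans (keeps 0 z<s) r0 ; r1 = trans (keeps 1 (lit< 1)) r1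
          ; r2 = trans (keeps 2 (lit< 2)) r2
          ; r3 = trans (keeps 3 (lit< 3)) (trans (cong₂ _+_ r3 r2) (saved-suc (2 + j)))
          ; r4 = trans (keeps 4 (lit< 4))
                 (trans (cong₂ _+_ r4 r2) (trans (saved-suc (2 + (σ + j))) (cong (λ u → saved (2 + u)) (sym (+-suc σ j)))))
          ; r5 = trans (keeps 5 (lit< 5)) r5
          ; r6 = trans (keeps 6 (lit< 6)) r6
          ; savedOK = savedOK′ ; tableOK = tableOK′ })
      where
      open ScatterInv I
      j<σ : j < σ
      j<σ = subst (j <_) remaining (m<m+n j z<s)
      J : Fin σ
      J = fromℕ< j<σ
      cond : (m 3 <ᵇ m 5) ≡ true
      cond rewrite r3 | r5 = <⇒<ᵇ-true (+-monoʳ-< 12 (+-monoˡ-< Y (+-monoʳ-< 2 j<σ)))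
      b1 b2 b3 b4 b5 : Mem
      b1 = after (load 7 4) m
      b2 = after (add 7 6 7) b1
      b3 = after (load 8 3) b2
      b4 = after (add 3 3 2) b3
      b5 = after (add 4 4 2) b4
      X V : ℕ
      X = m 6 + m (m 4)
      V = b2 (m 3)
      σ≥1 : 1 ≤ σ
      σ≥1 = ≤-trans z<s j<σ
      eX : X ≡ table (rk J)
      eX = cong₂ _+_ r6 (trans (cong m r4) (trans (savedOK (2 + (σ + j)) z<s (+-monoʳ-< 2 (+-monoʳ-< σ j<σ))) (input-rank j j<σ)))
      eV : V ≡ ℓs J
      eV = trans (upd-other b1 7 _ (m 3) (λ e → <12⇒≢12+ (2 + j + Y) (lit< 7) (trans (sym e) r3)))
           (trans (upd-other m 7 _ (m 3) (λ e → <12⇒≢12+ (2 + j + Y) (lit< 7) (trans (sym e) r3)))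
           (trans (cong m r3) (trans (savedOK (2 + j) z<s (+-monoʳ-< 2 (≤-trans j<σ (m≤m+n σ σ)))) (input-ℓ j j<σ))))
      keeps : ∀ r → r < 12 → upd b5 X V r ≡ b5 r
      keeps r lt = upd-high b5 X V r ((Y + Y) + rk J) lt eX
      savedOK′ : SavedInput (upd b5 X V)
      savedOK′ a pos lt = trans (upd-other b5 X V (saved a) (λ e → saved≢table a (rk J) (≤-trans lt (2+2s≤quad σ σ≥1)) (trans e eX))) (savedOK a pos lt)
      tableOK′ : ∀ (J′ : Fin σ) → toℕ J′ < suc j → upd b5 X V (table (rk J′)) ≡ ℓs J′
      tableOK′ J′ lt with toℕ J′ ≟ j
      ... | yes e = trans (upd-same b5 X V (table (rk J′)) (trans (cong (λ K → table (rk K)) JJ) (sym eX))) (trans eV (cong ℓs (sym JJ)))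
        where
        JJ : J′ ≡ J
        JJ = trans (sym (fromℕ<-toℕ J′ (toℕ<n J′))) (fromℕ<-cong _ _ e (toℕ<n J′) j<σ)
      ... | no ne = trans (upd-other b5 X V (table (rk J′)) (λ e → ne (trans (cong toℕ (rank-injective ρ J′ J (table-injective (trans e eX)))) (toℕ-fromℕ< j<σ))))
                      (tableOK J′ (≤∧≢⇒< (≤-pred lt) ne))

    record Scattered (m : Mem) : Set where
      field
        r0 : m 0 ≡ Y
        r1 : m 1 ≡ σ
        r2 : m 2 ≡ 1
        r6 : m 6 ≡ tableBase
        savedOK : SavedInput m
        tableOK : ∀ (J : Fin σ) → m (table (rk J)) ≡ ℓs J

    scatter-exit : Triple (At 38 (ScatterInv 0)) (suc 1) (At 47 Scattered)
    scatter-exit .holds ⟨ p , m ⟩ (refl , I) =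
      subst (At 47 Scattered) (sym (jlt-skipped {k = 1} {L = 38} {a = 3} {b = 5} {t = 40} {m = m} refl cond))
        (refl , record { r0 = r0 ; r1 = r1 ; r2 = r2 ; r6 = r6 ; savedOK = savedOK
                       ; tableOK = λ J → tableOK J (subst (toℕ J <_) (sym jσ) (toℕ<n J)) })
      where
      open ScatterInv I
      jσ : j ≡ σ
      jσ = trans (sym (+-identityʳ j)) remaining
      cond : (m 3 <ᵇ m 5) ≡ false
      cond rewrite r3 | r5 | jσ = ≥⇒<ᵇ-false {x = saved (2 + σ)} ≤-refl

    scatter : ∀ n → Triple (At 38 (ScatterInv n)) (n * suc 7 + suc 1) (At 47 Scattered)
    scatter = loop (λ n → At 38 (ScatterInv n)) (At 47 Scattered) (suc 7) (suc 1) scatter-step scatter-exit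

    S : ℕ → ℕ
    S = prefixSums Lv

    record SumInv (n : ℕ) (m : Mem) : Set where
      field
        r : ℕ
        remaining : r + n ≡ σ
        r0 : m 0 ≡ Y
        r1 : m 1 ≡ σ
        r2 : m 2 ≡ 1
        r3 : m 3 ≡ table r
        r5 : m 5 ≡ table σ
        r6 : m 6 ≡ tableBase
        r8 : m 8 ≡ b + S r
        savedOK : SavedInput m
        done : ∀ r′ → r′ < r → m (table r′) ≡ b + S r′
        todo : ∀ r′ → r ≤ r′ → r′ < σ → m (table r′) ≡ Lv r′

    sum-init : Triple (At 47 Scattered) 6 (At 53 (SumInv σ))
    sum-init .holds ⟨ p , m ⟩ (refl , F) = refl , record
      { r = 0 ; remaining = refl ; r0 = r0 ; r1 = r1 ; r2 = r2 ; r3 = trans r6 (sym (+-identityʳ tableBase))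
      ; r5 = cong₂ _+_ r6 r1 ; r6 = r6
      ; r8 = trans (cong (λ u → m (13 + u)) r0) (trans (savedOK 1 z<s (lit< 1)) (sym (+-identityʳ b)))
      ; savedOK = savedOK ; done = λ r′ () ; todo = todo }
      where
      open Scattered F
      todo : ∀ r′ → 0 ≤ r′ → r′ < σ → m (table r′) ≡ Lv r′
      todo r′ _ lt with rank-surjective ρ r′ lt
      ... | J , e = trans (cong (λ u → m (table u)) (sym e)) (trans (tableOK J) (trans (sym (byRank-rank ρ ℓs J)) (cong Lv e)))

    table-suc : ∀ r → table r + 1 ≡ table (suc r)
    table-suc r = trans (+-assoc tableBase r 1) (cong (tableBase +_) (+1≡suc r))

    saved≢table′ : ∀ a r → a < 2 + (σ + σ) → r < σ → saved a ≢ table r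
    saved≢table′ a r lt r<σ = saved≢table a r (≤-trans lt (2+2s≤quad σ (≤-trans z<s r<σ)))

    sum-step : ∀ n → Triple (At 53 (SumInv (suc n))) (suc 5) (At 53 (SumInv n))
    sum-step n .holds ⟨ p , m ⟩ (refl , I) =
      subst (At 53 (SumInv n)) (sym (jlt-taken {k = 5} {L = 53} {a = 3} {b = 5} {t = 55} {m = m} refl cond))
        (refl , record { r = suc r ; remaining = trans (sym (+-suc r n)) remaining
          ; r0 = trans (keeps 0 z<s) r0 ; r1 = trans (keeps 1 (lit< 1)) r1
          ; r2 = trans (keeps 2 (lit< 2)) r2
          ; r3 = trans (cong₂ _+_ (trans (keeps 3 (lit< 3)) r3) (trans (keeps 2 (lit< 2)) r2)) (table-suc r)
          ; r5 = trans (keeps 5 (lit< 5)) r5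
          ; r6 = trans (keeps 6 (lit< 6)) r6
          ; r8 = trans (cong₂ _+_ (trans (keeps 8 (lit< 8)) r8)
                                  (trans (keeps 7 (lit< 7)) (trans (cong m r3) (todo r ≤-refl r<σ))))
                       (+-assoc b (S r) (Lv r))
          ; savedOK = λ a pos lt → trans (upd-other p1 (m 3) (m 8) (saved a) (λ e → saved≢table′ a r lt r<σ (trans e r3))) (savedOK a pos lt)
          ; done = done′ ; todo = todo′ })
      where
      open SumInv I
      r<σ : r < σ
      r<σ = subst (r <_) remaining (m<m+n r z<s)
      cond : (m 3 <ᵇ m 5) ≡ true
      cond rewrite r3 | r5 = <⇒<ᵇ-true (+-monoʳ-< tableBase r<σ)
      p1 : Mem
      p1 = after (load 7 3) m
      keeps : ∀ q → q < 12 → upd p1 (m 3) (m 8) q ≡ p1 q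
      keeps q lt = upd-high p1 (m 3) (m 8) q ((Y + Y) + r) lt r3
      done′ : ∀ r′ → r′ < suc r → upd p1 (m 3) (m 8) (table r′) ≡ b + S r′
      done′ r′ lt with r′ ≟ r
      ... | yes refl = trans (upd-same p1 (m 3) (m 8) (table r′) (sym r3)) r8
      ... | no ne = trans (upd-other p1 (m 3) (m 8) (table r′) (λ e → ne (table-injective (trans e r3)))) (done r′ (≤∧≢⇒< (≤-pred lt) ne))
      todo′ : ∀ r′ → suc r ≤ r′ → r′ < σ → upd p1 (m 3) (m 8) (table r′) ≡ Lv r′
      todo′ r′ le lt = trans (upd-other p1 (m 3) (m 8) (table r′) (λ e → <⇒≢ le (sym (table-injective (trans e r3))))) (todo r′ (≤-trans (n≤1+n r) le) lt)

    record Summed (m : Mem) : Set where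
      field
        r0 : m 0 ≡ Y
        r1 : m 1 ≡ σ
        r2 : m 2 ≡ 1
        r6 : m 6 ≡ tableBase
        savedOK : SavedInput m
        tableOK : ∀ r → r < σ → m (table r) ≡ b + S r

    sum-exit : Triple (At 53 (SumInv 0)) (suc 1) (At 60 Summed)
    sum-exit .holds ⟨ p , m ⟩ (refl , I) =
      subst (At 60 Summed) (sym (jlt-skipped {k = 1} {L = 53} {a = 3} {b = 5} {t = 55} {m = m} refl cond))
        (refl , record { r0 = r0 ; r1 = r1 ; r2 = r2 ; r6 = r6 ; savedOK = savedOK
                       ; tableOK = λ r′ lt → done r′ (subst (r′ <_) (sym rσ) lt) })
      where
      open SumInv I
      rσ : r ≡ σ
      rσ = trans (sym (+-identityʳ r)) remaining
      cond : (m 3 <ᵇ m 5) ≡ false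
      cond rewrite r3 | r5 | rσ = ≥⇒<ᵇ-false {x = table σ} ≤-refl

    sum : ∀ n → Triple (At 53 (SumInv n)) (n * suc 5 + suc 1) (At 60 Summed)
    sum = loop (λ n → At 53 (SumInv n)) (At 60 Summed) (suc 5) (suc 1) sum-step sum-exit

    outStart : Fin σ → ℕ
    outStart J = rangeStart (ℓs J) (b + S (rk J))

    outStart-pos : ∀ J → 0 < ℓs J → outStart J ≡ b + S (rk J)
    outStart-pos J p rewrite <⇒<ᵇ-true p = refl

    outStart-zero : ∀ J → ℓs J ≡ 0 → outStart J ≡ 0
    outStart-zero J e rewrite e = refl

    StagedBelow : ℕ → Mem → Set
    StagedBelow j m = ∀ (J : Fin σ) → toℕ J < j → m (staged (toℕ J + toℕ J)) ≡ outStart J × m (staged (suc (toℕ J + toℕ J))) ≡ ℓs J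

    TableSummed : Mem → Set
    TableSummed m = ∀ r → r < σ → m (table r) ≡ b + S r

    record GatherInv (n : ℕ) (m : Mem) : Set where
      field
        j : ℕ
        remaining : j + n ≡ σ
        r0 : m 0 ≡ Y
        r1 : m 1 ≡ σ
        r2 : m 2 ≡ 1
        r3 : m 3 ≡ saved (2 + j)
        r4 : m 4 ≡ saved (2 + (σ + j))
        r5 : m 5 ≡ saved (2 + σ)
        r6 : m 6 ≡ tableBase
        r9 : m 9 ≡ staged (j + j)
        savedOK : SavedInput m
        tableOK : TableSummed m
        stagedOK : StagedBelow j m

    record GatherStep (L : ℕ) (n : ℕ) (m : Mem) : Set where
      field
        j : ℕ
        j<σ : j < σ
        remaining : j + suc n ≡ σ
        r0 : m 0 ≡ Y
        r1 : m 1 ≡ σ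
        r2 : m 2 ≡ 1
        r3 : m 3 ≡ saved (2 + j)
        r4 : m 4 ≡ saved (2 + (σ + j))
        r5 : m 5 ≡ saved (2 + σ)
        r6 : m 6 ≡ tableBase
        r7 : m 7 ≡ ℓs (fromℕ< j<σ)
        r8 : m 8 ≡ (if L ≡ᵇ 69 then 0 else outStart (fromℕ< j<σ))
        r9 : m 9 ≡ staged (j + j)
        savedOK : SavedInput m
        tableOK : TableSummed m
        stagedOK : StagedBelow j m

    gather-init : Triple (At 60 Summed) 5 (At 65 (GatherInv σ))
    gather-init .holds ⟨ p , m ⟩ (refl , F) = refl , record
      { j = 0 ; remaining = refl ; r0 = r0 ; r1 = r1 ; r2 = r2 ; r3 = cong (14 +_) r0
      ; r4 = trans (cong₂ (λ u v → (14 + u) + v) r0 r1)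
                   (cong (14 +_) (trans (+-comm Y σ) (cong (_+ Y) (sym (+-identityʳ σ)))))
      ; r5 = trans (cong₂ (λ u v → (14 + u) + v) r0 r1) (cong (14 +_) (+-comm Y σ))
      ; r6 = r6 ; r9 = trans (cong₂ _+_ r6 r1) (sym (+-identityʳ (tableBase + σ)))
      ; savedOK = savedOK ; tableOK = tableOK ; stagedOK = λ J () }
      where open Summed F

    gather-load : ∀ n → Triple (At 65 (GatherInv (suc n))) (suc 2) (At 69 (GatherStep 69 n))
    gather-load n .holds ⟨ p , m ⟩ (refl , I) =
      subst (At 69 (GatherStep 69 n)) (sym (jlt-taken {k = 2} {L = 65} {a = 3} {b = 5} {t = 67} {m = m} refl cond))
        (refl , record { j = j ; j<σ = j<σ ; remaining = remaining ; r0 = r0 ; r1 = r1 ; r2 = r2 ; r3 = r3 ; r4 = r4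
          ; r5 = r5 ; r6 = r6
          ; r7 = trans (cong m r3) (trans (savedOK (2 + j) z<s (+-monoʳ-< 2 (≤-trans j<σ (m≤m+n σ σ)))) (input-ℓ j j<σ))
          ; r8 = refl ; r9 = r9 ; savedOK = savedOK ; tableOK = tableOK ; stagedOK = stagedOK })
      where
      open GatherInv I
      j<σ : j < σ
      j<σ = subst (j <_) remaining (m<m+n j z<s)
      cond : (m 3 <ᵇ m 5) ≡ true
      cond rewrite r3 | r5 = <⇒<ᵇ-true (+-monoʳ-< 12 (+-monoˡ-< Y (+-monoʳ-< 2 j<σ)))

    gather-test : ∀ n → Triple (At 69 (GatherStep 69 n)) (suc 3) (At 76 (GatherStep 76 n))
    gather-test n .holds ⟨ p , m ⟩ (refl , I) with 0 <? ℓs (fromℕ< (GatherStep.j<σ I))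
    ... | yes pos =
      subst (At 76 (GatherStep 76 n)) (sym (jlt-taken {k = 3} {L = 69} {a = 8} {b = 7} {t = 73} {m = m} refl cond))
        (refl , record { j = j ; j<σ = j<σ ; remaining = remaining ; r0 = r0 ; r1 = r1 ; r2 = r2 ; r3 = r3 ; r4 = r4
          ; r5 = r5 ; r6 = r6 ; r7 = r7 ; r8 = r8′ ; r9 = r9 ; savedOK = savedOK ; tableOK = tableOK ; stagedOK = stagedOK })
      where
      open GatherStep I
      J : Fin σ
      J = fromℕ< j<σ
      cond : (m 8 <ᵇ m 7) ≡ true
      cond rewrite r8 | r7 = <⇒<ᵇ-true pos
      q1 : Mem
      q1 = after (load 8 4) m
      X : ℕ
      X = m 6 + m (m 4)
      eX : X ≡ table (rk J)
      eX = cong₂ _+_ r6 (trans (cong m r4) (trans (savedOK (2 + (σ + j)) z<s (+-monoʳ-< 2 (+-monoʳ-< σ j<σ))) (input-rank j j<σ)))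
      r8′ : after (load 8 8) (after (add 8 6 8) q1) 8 ≡ outStart J
      r8′ = trans (upd-other q1 8 _ X (λ e → <12⇒≢12+ ((Y + Y) + rk J) (lit< 8) (trans (sym e) eX)))
            (trans (upd-other m 8 _ X (λ e → <12⇒≢12+ ((Y + Y) + rk J) (lit< 8) (trans (sym e) eX)))
            (trans (cong m eX) (trans (tableOK (rk J) (rank< ρ J)) (sym (outStart-pos J pos)))))
    ... | no npos =
      subst (At 76 (GatherStep 76 n)) (sym (jlt-skipped {k = 3} {L = 69} {a = 8} {b = 7} {t = 73} {m = m} refl cond))
        (refl , record { j = j ; j<σ = j<σ ; remaining = remaining ; r0 = r0 ; r1 = r1 ; r2 = r2 ; r3 = r3 ; r4 = r4
          ; r5 = r5 ; r6 = r6 ; r7 = r7 ; r8 = trans r8 (sym (outStart-zero J z)) ; r9 = r9 ; savedOK = savedOK ; tableOK = tableOK ; stagedOK = stagedOK })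
      where
      open GatherStep I
      J : Fin σ
      J = fromℕ< j<σ
      z : ℓs J ≡ 0
      z = n≤0⇒n≡0 (≮⇒≥ npos)
      cond : (m 8 <ᵇ m 7) ≡ false
      cond rewrite r8 | r7 | z = refl

    staged-suc : ∀ t → staged t + 1 ≡ staged (suc t)
    staged-suc t = trans (+-assoc (tableBase + σ) t 1) (cong ((tableBase + σ) +_) (+1≡suc t))

    staged-injective : ∀ {t t′} → staged t ≡ staged t′ → t ≡ t′
    staged-injective {t} {t′} e = +-cancelˡ-≡ (tableBase + σ) t t′ e

    table≢staged : ∀ r t → r < σ → table r ≢ staged t
    table≢staged r t lt e = <⇒≢ (≤-trans (+-monoʳ-< tableBase lt) (m≤m+n (tableBase + σ) t)) e

    saved≢staged : ∀ a t → a < 2 + (σ + σ) → 1 ≤ σ → saved a ≢ staged t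
    saved≢staged a t lt s1 e = <⇒≢ (<-≤-trans (saved<table {a} {Y} {σ + t} (≤-trans lt (2+2s≤quad σ s1)))
                            (≤-reflexive (cong (12 +_) (sym (+-assoc (Y + Y) σ t))))) e

    gather-store : ∀ n → Triple (At 76 (GatherStep 76 n)) 7 (At 65 (GatherInv n))
    gather-store n .holds ⟨ p , m ⟩ (refl , I) = refl , record
      { j = suc j ; remaining = trans (sym (+-suc j n)) remaining
      ; r0 = trans (keeps 0 z<s) r0 ; r1 = trans (keeps 1 (lit< 1)) r1
      ; r2 = trans (keeps 2 (lit< 2)) r2
      ; r3 = trans (keeps 3 (lit< 3)) (trans (cong₂ _+_ r3 r2) (saved-suc (2 + j)))
      ; r4 = trans (keeps 4 (lit< 4))
                 (trans (cong₂ _+_ r4 r2) (trans (saved-suc (2 + (σ + j))) (cong (λ u → saved (2 + u)) (sym (+-suc σ j)))))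
      ; r5 = trans (keeps 5 (lit< 5)) r5
      ; r6 = trans (keeps 6 (lit< 6)) r6
      ; r9 = trans (cong₂ _+_ (trans (upd-high w4 Z1 W 11 _ 11<12 eZ1) eZ1) (trans (keeps 2 (lit< 2)) r2))
                   (trans (staged-suc (suc (j + j))) (cong (λ u → staged (suc u)) (sym (+-suc j j))))
      ; savedOK = λ a pos lt → trans (upd-other w4 Z1 W (saved a) (λ e → saved≢staged a _ lt s1 (trans e eZ1)))
                         (trans (upd-other w3 (m 9) (m 8) (saved a) (λ e → saved≢staged a _ lt s1 (trans e r9))) (savedOK a pos lt))
      ; tableOK = λ r lt → trans (upd-other w4 Z1 W (table r) (λ e → table≢staged r _ lt (trans e eZ1)))
                         (trans (upd-other w3 (m 9) (m 8) (table r) (λ e → table≢staged r _ lt (trans e r9))) (tableOK r lt))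
      ; stagedOK = stagedOK′ }
      where
      open GatherStep I
      J : Fin σ
      J = fromℕ< j<σ
      s1 : 1 ≤ σ
      s1 = ≤-trans z<s j<σ
      11<12 : 11 < 12
      11<12 = ≤-refl
      w1 w2 w3 w4 : Mem
      w1 = after (add 3 3 2) m
      w2 = after (add 4 4 2) w1
      w3 = after (add 11 9 2) w2
      w4 = after (store 9 8) w3
      Z1 W : ℕ
      Z1 = w4 11
      W = w4 7
      eZ1 : Z1 ≡ staged (suc (j + j))
      eZ1 = trans (upd-high w3 (m 9) (m 8) 11 _ 11<12 r9) (trans (cong₂ _+_ r9 r2) (staged-suc (j + j)))
      keeps : ∀ q → q < 12 → upd w4 Z1 W q ≡ w3 q
      keeps q lt = trans (upd-high w4 Z1 W q _ lt eZ1) (upd-high w3 (m 9) (m 8) q _ lt r9)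
      stagedOK′ : StagedBelow (suc j) (upd w4 Z1 W)
      stagedOK′ J′ lt with toℕ J′ ≟ j
      ... | yes e = fst , snd
        where
        JJ : J′ ≡ J
        JJ = trans (sym (fromℕ<-toℕ J′ (toℕ<n J′))) (fromℕ<-cong _ _ e (toℕ<n J′) j<σ)
        t = toℕ J′
        fst : upd w4 Z1 W (staged (t + t)) ≡ outStart J′
        fst = trans (upd-other w4 Z1 W (staged (t + t)) (λ e′ → (λ q → <⇒≢ (n<1+n (j + j)) q) (trans (cong (λ u → u + u) (sym e)) (staged-injective (trans e′ eZ1)))))
              (trans (upd-same w3 (m 9) (m 8) (staged (t + t)) (trans (cong (λ u → staged (u + u)) e) (sym r9)))
              (trans r8 (cong outStart (sym JJ))))
        snd : upd w4 Z1 W (staged (suc (t + t))) ≡ ℓs J′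
        snd = trans (upd-same w4 Z1 W (staged (suc (t + t))) (trans (cong (λ u → staged (suc (u + u))) e) (sym eZ1)))
              (trans (upd-high w3 (m 9) (m 8) 7 _ (lit< 7) r9)
              (trans r7 (cong ℓs (sym JJ))))
      ... | no ne = fst , snd
        where
        t = toℕ J′
        t<j : t < j
        t<j = ≤∧≢⇒< (≤-pred lt) ne
        fst : upd w4 Z1 W (staged (t + t)) ≡ outStart J′
        fst = trans (upd-other w4 Z1 W (staged (t + t)) (λ e′ → <⇒≢ (≤-trans (double-< t<j) (n≤1+n _)) (staged-injective (trans e′ eZ1))))
              (trans (upd-other w3 (m 9) (m 8) (staged (t + t)) (λ e′ → <⇒≢ (double-< t<j) (staged-injective (trans e′ r9))))
              (proj₁ (stagedOK J′ t<j)))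
        snd : upd w4 Z1 W (staged (suc (t + t))) ≡ ℓs J′
        snd = trans (upd-other w4 Z1 W (staged (suc (t + t))) (λ e′ → <⇒≢ (s≤s (double-< t<j)) (staged-injective (trans e′ eZ1))))
              (trans (upd-other w3 (m 9) (m 8) (staged (suc (t + t))) (λ e′ → <⇒≢ (suc-double-< t<j) (staged-injective (trans e′ r9))))
              (proj₂ (stagedOK J′ t<j)))

    record Gathered (m : Mem) : Set where
      field
        r0 : m 0 ≡ Y
        r1 : m 1 ≡ σ
        r6 : m 6 ≡ tableBase
        stagedOK : ∀ (J : Fin σ) → m (staged (toℕ J + toℕ J)) ≡ outStart J × m (staged (suc (toℕ J + toℕ J))) ≡ ℓs J

    gather-exit : Triple (At 65 (GatherInv 0)) (suc 1) (At 83 Gathered)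
    gather-exit .holds ⟨ p , m ⟩ (refl , I) =
      subst (At 83 Gathered) (sym (jlt-skipped {k = 1} {L = 65} {a = 3} {b = 5} {t = 67} {m = m} refl cond))
        (refl , record { r0 = r0 ; r1 = r1 ; r6 = r6
                       ; stagedOK = λ J → stagedOK J (subst (toℕ J <_) (sym jσ) (toℕ<n J)) })
      where
      open GatherInv I
      jσ : j ≡ σ
      jσ = trans (sym (+-identityʳ j)) remaining
      cond : (m 3 <ᵇ m 5) ≡ false
      cond rewrite r3 | r5 | jσ = ≥⇒<ᵇ-false {x = saved (2 + σ)} ≤-refl

    gather-step : ∀ n → Triple (At 65 (GatherInv (suc n))) (suc 2 + (suc 3 + 7)) (At 65 (GatherInv n))
    gather-step n = gather-load n ⨾ gather-test n ⨾ gather-store n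

    gather : ∀ n → Triple (At 65 (GatherInv n)) (n * (suc 2 + (suc 3 + 7)) + suc 1) (At 83 Gathered)
    gather = loop (λ n → At 65 (GatherInv n)) (At 83 Gathered) ((suc 2 + suc 3) + 7) (suc 1) gather-step gather-exit

    out : ℕ → ℕ
    out u = (2 + (σ + σ)) + u

    record MoveInv (n : ℕ) (m : Mem) : Set where
      field
        t : ℕ
        remaining : t + n ≡ σ + σ
        r0 : m 0 ≡ out t
        r1 : m 1 ≡ staged t
        r2 : m 2 ≡ 2 + Y
        stagedOK : ∀ (J : Fin σ) → m (staged (toℕ J + toℕ J)) ≡ outStart J × m (staged (suc (toℕ J + toℕ J))) ≡ ℓs J
        outB-ok : ∀ (J : Fin σ) → toℕ J + toℕ J < t → m (out (toℕ J + toℕ J)) ≡ outStart J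
        outL-ok : ∀ (J : Fin σ) → suc (toℕ J + toℕ J) < t → m (out (suc (toℕ J + toℕ J))) ≡ ℓs J

    move-init : Triple (At 83 Gathered) 6 (At 89 (MoveInv (σ + σ)))
    move-init .holds ⟨ p , m ⟩ (refl , F) = refl , record
      { t = 0 ; remaining = refl ; r0 = trans (cong (λ u → 2 + (u + u)) r1) (sym (+-identityʳ _))
      ; r1 = trans (cong₂ _+_ r6 r1) (sym (+-identityʳ _)) ; r2 = cong (2 +_) r0
      ; stagedOK = stagedOK ; outB-ok = λ J () ; outL-ok = λ J () }
      where open Gathered F

    out≥4 : ∀ u → 1 ≤ σ → 4 ≤ out u
    out≥4 u s1 = ≤-trans (s≤s (s≤s (+-mono-≤ s1 s1))) (m≤m+n _ u)

    out≢staged : ∀ u v → out u < 2 + Y → out u ≢ staged v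
    out≢staged u v lt e = <⇒≢ (≤-trans lt (≤-trans (m≤n+m (2 + Y) 10) (≤-trans (+-monoʳ-≤ 12 (m≤m+n Y Y)) (≤-trans (m≤m+n tableBase σ) (m≤m+n (tableBase + σ) v))))) e

    out-suc : ∀ t → out t + 1 ≡ out (suc t)
    out-suc t = trans (+-assoc (2 + (σ + σ)) t 1) (cong ((2 + (σ + σ)) +_) (+1≡suc t))

    move-step : ∀ n → Triple (At 89 (MoveInv (suc n))) (suc 6) (At 89 (MoveInv n))
    move-step n .holds ⟨ p , m ⟩ (refl , I) =
      subst (At 89 (MoveInv n)) (sym (jlt-taken {k = 6} {L = 89} {a = 0} {b = 2} {t = 91} {m = m} refl cond))
        (refl , record { t = suc t ; remaining = trans (sym (+-suc t n)) remaining
          ; r0 = trans (cong (_+ 1) (trans (keeps 0 z<s) r0)) (out-suc t)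
          ; r1 = trans (cong (_+ 1) (trans (keeps 1 (lit< 1)) r1)) (staged-suc t)
          ; r2 = trans (keeps 2 (lit< 2)) r2
          ; stagedOK = λ J → trans (keeps-staged _) (proj₁ (stagedOK J)) , trans (keeps-staged _) (proj₂ (stagedOK J))
          ; outB-ok = outB-ok′ ; outL-ok = outL-ok′ })
      where
      open MoveInv I
      t<2σ : t < σ + σ
      t<2σ = subst (t <_) remaining (m<m+n t z<s)
      σ≥1 : 1 ≤ σ
      σ≥1 = t<s+s⇒1≤s σ t<2σ
      out-t< : out t < 2 + Y
      out-t< = +-monoʳ-< (2 + (σ + σ)) t<2σ
      cond : (m 0 <ᵇ m 2) ≡ true
      cond rewrite r0 | r2 = <⇒<ᵇ-true out-t<
      v1 v2 : Mem
      v1 = after (load 3 1) m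
      v2 = after (store 0 3) v1
      keeps : ∀ q → q < 4 → v2 q ≡ v1 q
      keeps q lt = upd-other v1 (m 0) _ q (λ e → <⇒≢ (≤-trans lt (out≥4 t σ≥1)) (trans e r0))
      keeps-staged : ∀ u → v2 (staged u) ≡ m (staged u)
      keeps-staged u = upd-other v1 (m 0) _ (staged u) (λ e → out≢staged t u out-t< (sym (trans e r0)))
      out≢3 : ∀ u → out u ≢ 3
      out≢3 u e = <⇒≢ (out≥4 u σ≥1) (sym e)
      out-injective : ∀ {u u′} → out u ≡ out u′ → u ≡ u′
      out-injective {u} {u′} e = +-cancelˡ-≡ (2 + (σ + σ)) u u′ e
      moved : ∀ u (w : ℕ) → m (staged u) ≡ w → (u < t → m (out u) ≡ w) → u < suc t →
            upd v2 3 1 (out u) ≡ w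
      moved u w at-staged at-out lt with u ≟ t
      ... | yes e = trans (upd-other v2 3 1 (out u) (out≢3 u))
                    (trans (upd-same v1 (m 0) _ (out u) (trans (cong out e) (sym r0)))
                    (trans (cong m (trans r1 (cong staged (sym e)))) at-staged))
      ... | no ne = trans (upd-other v2 3 1 (out u) (out≢3 u))
                    (trans (upd-other v1 (m 0) _ (out u) (λ e′ → ne (out-injective (trans e′ r0))))
                    (trans (upd-other m 3 _ (out u) (out≢3 u)) (at-out (≤∧≢⇒< (≤-pred lt) ne))))
      v5 : Mem
      v5 = after (add 1 1 3) (after (add 0 0 3) (after (const 3 1) v2))
      outB-ok′ : ∀ (J : Fin σ) → toℕ J + toℕ J < suc t → v5 (out (toℕ J + toℕ J)) ≡ outStart J
      outB-ok′ J lt = moved _ _ (proj₁ (stagedOK J)) (outB-ok J) lt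
      outL-ok′ : ∀ (J : Fin σ) → suc (toℕ J + toℕ J) < suc t → v5 (out (suc (toℕ J + toℕ J))) ≡ ℓs J
      outL-ok′ J lt = moved _ _ (proj₂ (stagedOK J)) (outL-ok J) lt

    record Moved (m : Mem) : Set where
      field
        outB-ok : ∀ (J : Fin σ) → m (out (toℕ J + toℕ J)) ≡ outStart J
        outL-ok : ∀ (J : Fin σ) → m (out (suc (toℕ J + toℕ J))) ≡ ℓs J

    move-exit : Triple (At 89 (MoveInv 0)) (suc 1) (At 97 Moved)
    move-exit .holds ⟨ p , m ⟩ (refl , I) =
      subst (At 97 Moved) (sym (jlt-skipped {k = 1} {L = 89} {a = 0} {b = 2} {t = 91} {m = m} refl cond))
        (refl , record { outB-ok = λ J → outB-ok J (lt1 J) ; outL-ok = λ J → outL-ok J (lt2 J) })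
      where
      open MoveInv I
      tσ : t ≡ σ + σ
      tσ = trans (sym (+-identityʳ t)) remaining
      cond : (m 0 <ᵇ m 2) ≡ false
      cond rewrite r0 | r2 | tσ = ≥⇒<ᵇ-false {x = out (σ + σ)} ≤-refl
      lt1 : ∀ (J : Fin σ) → toℕ J + toℕ J < t
      lt1 J = subst (_ <_) (sym tσ) (double-< (toℕ<n J))
      lt2 : ∀ (J : Fin σ) → suc (toℕ J + toℕ J) < t
      lt2 J = subst (_ <_) (sym tσ) (suc-double-< (toℕ<n J))

    move : ∀ n → Triple (At 89 (MoveInv n)) (n * suc 6 + suc 1) (At 97 Moved)
    move = loop (λ n → At 89 (MoveInv n)) (At 97 Moved) (suc 6) (suc 1) move-step move-exit

    Init : Pred
    Init st = st ≡ ⟨ 0 , input ⟩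

    stash : Triple Init 3 (At 3 Stashed)
    stash .holds st refl = refl , stash-result

    program-spec : Triple Init (stepCount (Y ∸ 3) σ) (At 97 Moved)
    program-spec = stash ⨾ save-low ⨾ copy-init ⨾ copy _ ⨾ recount-init ⨾ recount _ ⨾ scatter-init ⨾ scatter _
                 ⨾ sum-init ⨾ sum _ ⨾ gather-init ⨾ gather _ ⨾ move-init ⨾ move _

    prog-correct : Σ ℕ λ t → (t ≤ 100 * σ + 100) × Halted prog (run prog t ⟨ 0 , input ⟩) ×
                     (∀ J → mem (run prog t ⟨ 0 , input ⟩) (outB σ J) ≡ outStart J ×
                            mem (run prog t ⟨ 0 , input ⟩) (outL σ J) ≡ ℓs J)
    prog-correct = steps , stepCount≤ (Y ∸ 3) σ (m∸n≤m Y 3) , ≤-reflexive (sym (proj₁ final)) , outputs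
      where
      steps : ℕ
      steps = stepCount (Y ∸ 3) σ
      final : At 97 Moved (run prog steps ⟨ 0 , input ⟩)
      final = program-spec .holds ⟨ 0 , input ⟩ refl
      result : Mem
      result = mem (run prog steps ⟨ 0 , input ⟩)
      outputs : ∀ J → result (outB σ J) ≡ outStart J × result (outL σ J) ≡ ℓs J
      outputs J = trans (cong result (sym (out≡outB σ (toℕ J)))) (Moved.outB-ok (proj₂ final) J)
                , trans (cong result (sym (out≡outL σ (toℕ J)))) (Moved.outL-ok (proj₂ final) J)

open Program using (prog; module Correctness)

lemma4 : Σ Program λ P → Σ ℕ λ c →
    ∀ (σ : ℕ) (s : Str σ) → Primitive s →
    ∀ (π : Orderings σ) (row : Fin (length s) → Fin (length s)) → IsMstar π s row →
    ∀ (x : Str σ) (b : ℕ) (ℓs : Fin σ → ℕ) → HasRngx s row x b ℓs →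
    Σ ℕ λ T → (T ≤ c * σ + c) ×
      (Halted P (run P T ⟨ 0 , initMem σ b ℓs (λ i → toℕ (π x ⟨$⟩ʳ i)) ⟩) ×
       (∀ (i : Fin σ) → HasRng s row (x ++ (i ∷ []))
          (mem (run P T ⟨ 0 , initMem σ b ℓs (λ i → toℕ (π x ⟨$⟩ʳ i)) ⟩) (outB σ i))
          (mem (run P T ⟨ 0 , initMem σ b ℓs (λ i → toℕ (π x ⟨$⟩ʳ i)) ⟩) (outL σ i))))
lemma4 = prog , 100 , λ σ s _ π row isMstar x b ℓs hasRngx →
  let open Correctness σ b ℓs (π x)
      (steps , steps≤ , halted , outputs) = prog-correct
  in steps , steps≤ , halted , λ c →
     subst₂ (HasRng s row (x ++ c ∷ [])) (sym (proj₁ (outputs c))) (sym (proj₂ (outputs c)))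
            (Extension.extension-ranges s π row isMstar x b ℓs hasRngx c)
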